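{- Let $C$ be a cycle (viewed as a set of edges, called lines) with positive line weights $w_{ij}>0$ for $(i,j)\in C$, and let $M$ be a constant with $M \ge \sum_{(i,j)\in C} w_{ij}$. Let $m\neq n$ be two buses (vertices) on $C$; the cycle is partitioned into two edge-disjoint paths $\underline{\rho}_{mn}$ and $\overline{\rho}_{mn}$, each connecting $m$ and $n$, with $w(\underline{\rho}_{mn}) < w(\overline{\rho}_{mn})$, where $w(\rho):=\sum_{(i,j)\in\rho} w_{ij}$. Define the mixed-integer set $$\mathcal{R}_{\langle m,n\rangle} = \Bigl\{(\delta\theta_{mn},y)\in \mathbb{R}\times\{0,1\}^{|C|} : |\delta\theta_{mn}|\le w(\underline{\rho}_{mn}) + \sum_{(i,j)\in\underline{\rho}_{mn}}(M-w_{ij})(1-y_{ij}),\ |\delta\theta_{mn}|\le w(\overline{\rho}_{mn}) + \sum_{(i,j)\in\overline{\rho}_{mn}}(M-w_{ij})(1-y_{ij}),\ |\delta\theta_{mn}|\le M\Bigr\}.$$ Let $\mathcal{P}_{\langle m,n\rangle}$ be the polytope of all $(\delta\theta_{mn}, y, \underline{z}_{mn}, \overline{z}_{mn}, \overline{\zeta}_{mn})\in\mathbb{R}\times\mathbb{R}^{|C|}\times\mathbb{R}\times\mathbb{R}\times\mathbb{R}$ satisfying (a) $\underline{z}_{mn}\le y_{ij}$ for all $(i,j)\in\underline{\rho}_{mn}$ and $\underline{z}_{mn}\ge \sum_{(i,j)\in\underline{\rho}_{mn}} y_{ij} - |\underline{\rho}_{mn}| + 1$; (b) $\overline{z}_{mn}\le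 y_{ij}$ for all $(i,j)\in\overline{\rho}_{mn}$ and $\overline{z}_{mn}\ge \sum_{(i,j)\in\overline{\rho}_{mn}} y_{ij} - |\overline{\rho}_{mn}| + 1$; (c) $0\le \overline{\zeta}_{mn}\le \overline{z}_{mn}$, $0\le\overline{\zeta}_{mn}\le 1-\underline{z}_{mn}$, $\overline{\zeta}_{mn}\ge \overline{z}_{mn}-\underline{z}_{mn}$; (d) $|\delta\theta_{mn}| \le w(\underline{\rho}_{mn})\,\underline{z}_{mn} + w(\overline{\rho}_{mn})\,\overline{\zeta}_{mn} + M(1-\underline{z}_{mn}-\overline{\zeta}_{mn})$; (e) $y\in[0,1]^{|C|}$, $\underline{z}_{mn},\overline{z}_{mn}\in[0,1]$. Then this linear system is an extended formulation of $\operatorname{conv}(\mathcal{R}_{\langle m,n\rangle})$, i.e. $\operatorname{conv}(\mathcal{R}_{\langle m,n\rangle}) = \operatorname{proj}_{\delta\theta,y}(\mathcal{P}_{\langle m,n\rangle})$ (the formulation is sharp with respect to $(\delta\theta,y)$).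
   Context: This arises from DC optimal transmission switching: $y_{ij}\in\{0,1\}$ indicates whether line $(i,j)$ is active, $w_{ij}=\overline{f}_{ij}x_{ij}$ is the product of the thermal capacity and reactance of the line, and $\delta\theta_{mn}:=\theta_n-\theta_m$ is the voltage-angle difference between buses $m$ and $n$. In the paper, $M$ is the sum of the weights of all lines of the network containing $C$ (hence $M\ge w(C)>w(\overline{\rho}_{mn})$). $|\rho|$ denotes the number of lines in path $\rho$. A formulation is sharp if the projection of its LP relaxation onto the original variables equals the convex hull of the mixed-integer set. -}

module Defs where

open import Level using (Level; _⊔_; suc)
open import Data.Nat as ℕ using (ℕ; zero)
import Data.Nat as Nat
open import Data.Fin using (Fin; toℕ) renaming (zero to fzero; suc to fsuc)
open import Data.Bool using (Bool; true; false; if_then_else_; not; _∧_)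
open import Data.Product using (_×_; Σ; ∃; ∃-syntax)
open import Data.Sum using (_⊎_)
open import Relation.Nullary using (¬_)
open import Relation.Binary.PropositionalEquality using (_≡_)
open import Relation.Binary.Structures using (IsTotalOrder)
open import Algebra.Structures using (IsCommutativeRing)

-- Ordered fields (the paper works over ℝ; we state the result over an
-- arbitrary ordered field, ℝ being one instance).  Equality is _≡_.

record OrderedField (c ℓ : Level) : Set (Level.suc (c ⊔ ℓ)) where
  infixl 6 _+_
  infixl 7 _*_
  infix  4 _≤_
  field
    Carrier : Set c
    _+_ _*_ : Carrier → Carrier → Carrier
    -_      : Carrier → Carrier
    0# 1#   : Carrier
    _≤_     : Carrier → Carrier → Set ℓ
    isCommutativeRing : IsCommutativeRing _≡_ _+_ _*_ -_ 0# 1#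
    _⁻¹     : (x : Carrier) → ¬ (x ≡ 0#) → Carrier
    ⁻¹-inverse : (x : Carrier) (x≢0 : ¬ (x ≡ 0#)) → x * (x ⁻¹) x≢0 ≡ 1#
    0≢1     : ¬ (0# ≡ 1#)
    isTotalOrder : IsTotalOrder _≡_ _≤_
    +-monoˡ-≤ : ∀ {x y} z → x ≤ y → x + z ≤ y + z
    *-nonneg  : ∀ {x y} → 0# ≤ x → 0# ≤ y → 0# ≤ x * y

  infixl 6 _-_
  _-_ : Carrier → Carrier → Carrier
  x - y = x + (- y)

  infix 4 _<_
  _<_ : Carrier → Carrier → Set (c ⊔ ℓ)
  x < y = (x ≤ y) × ¬ (x ≡ y)

module _ {c ℓ : Level} (F : OrderedField c ℓ) where
  open OrderedField F

  Σ[_] : (k : ℕ) → (Fin k → Carrier) → Carrier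
  Σ[ zero ] f = 0#
  Σ[ ℕ.suc k ] f = f fzero + Σ[ k ] (λ i → f (fsuc i))

  ΣOn : (k : ℕ) → (Fin k → Bool) → (Fin k → Carrier) → Carrier
  ΣOn k S f = Σ[ k ] (λ i → if S i then f i else 0#)

  card : (k : ℕ) → (Fin k → Bool) → Carrier
  card k S = ΣOn k S (λ _ → 1#)

  AbsLe : Carrier → Carrier → Set ℓ
  AbsLe x a = (x ≤ a) × (- x ≤ a)

  Binary : Carrier → Set c
  Binary x = (x ≡ 0#) ⊎ (x ≡ 1#)

  InR : (k : ℕ) (w : Fin k → Carrier) (M : Carrier) (L U : Fin k → Bool)
        → Carrier → (Fin k → Carrier) → Set (c ⊔ ℓ)
  InR k w M L U δ y =
      (∀ i → Binary (y i))
    × AbsLe δ (ΣOn k L w + ΣOn k L (λ i → (M - w i) * (1# - y i)))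
    × AbsLe δ (ΣOn k U w + ΣOn k U (λ i → (M - w i) * (1# - y i)))
    × AbsLe δ M

  InP : (k : ℕ) (w : Fin k → Carrier) (M : Carrier) (L U : Fin k → Bool)
        → Carrier → (Fin k → Carrier) → Carrier → Carrier → Carrier → Set ℓ
  InP k w M L U δ y zl zu ζ =
      ((i : Fin k) → L i ≡ true → zl ≤ y i)
    × (ΣOn k L y - card k L + 1# ≤ zl)
    × ((i : Fin k) → U i ≡ true → zu ≤ y i)
    × (ΣOn k U y - card k U + 1# ≤ zu)
    × (0# ≤ ζ) × (ζ ≤ zu) × (ζ ≤ 1# - zl) × (zu - zl ≤ ζ)
    × AbsLe δ (ΣOn k L w * zl + ΣOn k U w * ζ + M * (1# - zl - ζ))
    × (∀ i → (0# ≤ y i) × (y i ≤ 1#))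
    × (0# ≤ zl) × (zl ≤ 1#) × (0# ≤ zu) × (zu ≤ 1#)

  -- (δθ, y) is in the convex hull of R: a finite convex combination of
  -- points of R (equality of the y-part taken pointwise).
  InConvR : (k : ℕ) (w : Fin k → Carrier) (M : Carrier) (L U : Fin k → Bool)
            → Carrier → (Fin k → Carrier) → Set (c ⊔ ℓ)
  InConvR k w M L U δ y =
    ∃[ N ] Σ (Fin N → Carrier) λ λs → Σ (Fin N → Carrier) λ δs →
      Σ (Fin N → Fin k → Carrier) λ ys →
          (∀ j → 0# ≤ λs j)
        × (Σ[ N ] λs ≡ 1#)
        × (∀ j → InR k w M L U (δs j) (ys j))
        × (δ ≡ Σ[ N ] (λ j → λs j * δs j))
        × (∀ i → y i ≡ Σ[ N ] (λ j → λs j * ys j i))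

  InProjP : (k : ℕ) (w : Fin k → Carrier) (M : Carrier) (L U : Fin k → Bool)
            → Carrier → (Fin k → Carrier) → Set (c ⊔ ℓ)
  InProjP k w M L U δ y =
    Σ Carrier λ zl → Σ Carrier λ zu → Σ Carrier λ ζ → InP k w M L U δ y zl zu ζ

-- The cycle C: buses Fin k, line i ∈ Fin k joins bus i and bus i+1 (mod k).
-- For buses m ≠ n the two m–n paths of C are the arc of lines
-- {i | min(m,n) ≤ i < max(m,n)} and its complement.

arc : {k : ℕ} → Fin k → Fin k → Fin k → Bool
arc m n i = (Nat._≤ᵇ_ (Nat._⊓_ (toℕ m) (toℕ n)) (toℕ i))
          ∧ (Nat._<ᵇ_ (toℕ i) (Nat._⊔_ (toℕ m) (toℕ n)))

coarc : {k : ℕ} → Fin k → Fin k → Fin k → Bool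
coarc m n i = not (arc m n i)

{-# OPTIONS --safe #-}
module Submission where

-- (⊆) A point (δ, v) of R with v ∈ {0,1}^C lifts to P by z̲ = [ρ̲ intact in v], z̄ = [ρ̄ intact],
-- ζ̄ = [ρ̄ intact, ρ̲ broken].  At this lift (d) bounds |δ| by w(ρ̲), w(ρ̄) or M according to which
-- paths v breaks, which is exactly what R allows at v; and P is convex.
-- (⊇) Given a point of P, realise y as the mean of a distribution on {0,1}^C built one line at a
-- time: the deficit 1 - yᵢ of a line is laid out on [0,1) right after those of the previous lines
-- of its path, wrapping around.  Then ρ̲ breaks with probability at least min(1, Σ_ρ̲ (1 - y)) ≥ 1 - z̲,
-- likewise ρ̄ with 1 - z̄, and the two events are nested, so both paths break with probability at
-- least 1 - z̲ - ζ̄.  Give each vector v the angle r·b(v), where b(v) is the largest |δ| allowed by R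
-- at v and r = δ / E[b]: these bounds turn (d) into |δ| ≤ E[b], that is |r| ≤ 1.

open import Defs

open import Level using (Level; _⊔_)
open import Function using (_∘_)
open import Function.Bundles using (_⇔_; mk⇔; Equivalence)
open import Data.Empty using (⊥-elim)
open import Data.Bool using (Bool; true; false; if_then_else_; not; _∧_)
open import Data.Bool.Properties using (_≟_; T-≡; T-∧; ∧-zeroʳ; not-involutive)
open import Data.Nat as ℕ using (ℕ; zero; suc)
import Data.Nat.Properties as ℕ
open import Data.Integer as ℤ using (ℤ; -[1+_]; _⊖_)
import Data.Integer.Properties as ℤ
open import Data.Sign as Sign using ()
open import Data.Fin using (Fin; toℕ) renaming (zero to fzero; suc to fsuc)
open import Data.Fin.Properties using (all?; ¬∀⟶∃¬; toℕ-injective)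
open import Data.Vec.Functional using (Vector; head; tail) renaming (_∷_ to _∷ᵛ_)
open import Data.List as List using (List; []; _∷_; _++_)
open import Data.List.Membership.Propositional.Properties using (∈-lookup)
open import Data.List.Relation.Unary.All as All using (All; []; _∷_)
open import Data.List.Relation.Unary.All.Properties as All using ()
open import Data.Maybe using (Maybe; just; nothing)
open import Data.Product using (_×_; _,_; proj₁; proj₂; ∃; map₂)
open import Data.Sum as Sum using (_⊎_; inj₁; inj₂)
open import Relation.Nullary using (¬_; Dec; yes; no; does; _→-dec_)
open import Relation.Binary.PropositionalEquality
  using (_≡_; refl; sym; trans; cong; cong₂; subst; subst₂; module ≡-Reasoning)
open import Relation.Binary.Definitions using (tri<; tri≈; tri>)
open import Relation.Binary.Structures using (IsTotalOrder)
open import Relation.Binary.Bundles using (Poset)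
import Relation.Binary.Reasoning.PartialOrder as PosetReasoning
open import Algebra.Bundles using (CommutativeRing)
import Algebra.Solver.Ring.AlmostCommutativeRing as ACR

module FieldSolver {c ℓ : Level} (F : OrderedField c ℓ) where
  open OrderedField F

  commutativeRing : CommutativeRing c c
  commutativeRing = record { isCommutativeRing = isCommutativeRing }

  open CommutativeRing commutativeRing
    using (semiring; ring; +-commutativeSemigroup; +-identityˡ; +-identityʳ; +-comm; -‿inverseʳ)
  -- The optimised multiplication makes fromℤ 1 reduce to 1#, so that solver equations
  -- mentioning :1 match goals mentioning 1#.
  open import Algebra.Properties.Semiring.Mult.TCOptimised semiring using (1+×; ×-homo-+; ×1-homo-*) renaming (_×_ to _×ₙ_)
  open import Algebra.Properties.Ring ring using (-‿distribˡ-*; -‿distribʳ-*; -‿involutive; -0#≈0#; -‿+-comm)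
  open import Algebra.Properties.CommutativeSemigroup +-commutativeSemigroup using (interchange)

  fromℤ : ℤ → Carrier
  fromℤ (ℤ.+ n) = n ×ₙ 1#
  fromℤ -[1+ n ] = - (suc n ×ₙ 1#)

  fromℤ-⊖ : ∀ m n → fromℤ (m ⊖ n) ≡ m ×ₙ 1# - n ×ₙ 1#
  fromℤ-⊖ zero zero = sym (-‿inverseʳ 0#)
  fromℤ-⊖ zero (suc n) = sym (+-identityˡ _)
  fromℤ-⊖ (suc m) zero = sym (trans (cong ((suc m ×ₙ 1#) +_) -0#≈0#) (+-identityʳ _))
  fromℤ-⊖ (suc m) (suc n) = begin
    fromℤ (suc m ⊖ suc n)                 ≡⟨ cong fromℤ (ℤ.[1+m]⊖[1+n]≡m⊖n m n) ⟩
    fromℤ (m ⊖ n)                         ≡⟨ fromℤ-⊖ m n ⟩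
    a - b                                 ≡⟨ sym (+-identityˡ _) ⟩
    0# + (a - b)                          ≡⟨ cong (_+ (a - b)) (sym (-‿inverseʳ 1#)) ⟩
    (1# - 1#) + (a - b)                   ≡⟨ interchange 1# (- 1#) a (- b) ⟩
    (1# + a) + (- 1# + - b)               ≡⟨ cong ((1# + a) +_) (-‿+-comm 1# b) ⟩
    (1# + a) - (1# + b)                   ≡⟨ sym (cong₂ _-_ (1+× m 1#) (1+× n 1#)) ⟩
    suc m ×ₙ 1# - suc n ×ₙ 1#             ∎
    where
      open ≡-Reasoning
      a = m ×ₙ 1#
      b = n ×ₙ 1#

  fromℤ-+ : ∀ i j → fromℤ (i ℤ.+ j) ≡ fromℤ i + fromℤ j
  fromℤ-+ (ℤ.+ m) (ℤ.+ n) = ×-homo-+ 1# m n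
  fromℤ-+ (ℤ.+ m) -[1+ n ] = fromℤ-⊖ m (suc n)
  fromℤ-+ -[1+ m ] (ℤ.+ n) = trans (fromℤ-⊖ n (suc m)) (+-comm _ _)
  fromℤ-+ -[1+ m ] -[1+ n ] = begin
    - (suc (suc (m ℕ.+ n)) ×ₙ 1#)         ≡⟨ cong (λ k → - (suc k ×ₙ 1#)) (sym (ℕ.+-suc m n)) ⟩
    - ((suc m ℕ.+ suc n) ×ₙ 1#)           ≡⟨ cong -_ (×-homo-+ 1# (suc m) (suc n)) ⟩
    - (suc m ×ₙ 1# + suc n ×ₙ 1#)         ≡⟨ sym (-‿+-comm _ _) ⟩
    - (suc m ×ₙ 1#) + - (suc n ×ₙ 1#)     ∎
    where open ≡-Reasoning

  fromℤ-neg : ∀ i → fromℤ (ℤ.- i) ≡ - fromℤ i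
  fromℤ-neg -[1+ n ] = sym (-‿involutive _)
  fromℤ-neg (ℤ.+ zero) = sym -0#≈0#
  fromℤ-neg (ℤ.+ suc n) = refl

  fromℤ-* : ∀ i j → fromℤ (i ℤ.* j) ≡ fromℤ i * fromℤ j
  fromℤ-* (ℤ.+ m) (ℤ.+ n) = trans (cong fromℤ (ℤ.+◃n≡+n (m ℕ.* n))) (×1-homo-* m n)
  fromℤ-* (ℤ.+ m) -[1+ n ] = begin
    fromℤ (Sign.- ℤ.◃ (m ℕ.* suc n))      ≡⟨ cong fromℤ (ℤ.-◃n≡-n (m ℕ.* suc n)) ⟩
    fromℤ (ℤ.- (ℤ.+ (m ℕ.* suc n)))         ≡⟨ fromℤ-neg (ℤ.+ (m ℕ.* suc n)) ⟩
    - ((m ℕ.* suc n) ×ₙ 1#)               ≡⟨ cong -_ (×1-homo-* m (suc n)) ⟩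
    - (m ×ₙ 1# * suc n ×ₙ 1#)             ≡⟨ -‿distribʳ-* _ _ ⟩
    m ×ₙ 1# * - (suc n ×ₙ 1#)             ∎
    where open ≡-Reasoning
  fromℤ-* -[1+ m ] (ℤ.+ n) = begin
    fromℤ (Sign.- ℤ.◃ (suc m ℕ.* n))      ≡⟨ cong fromℤ (ℤ.-◃n≡-n (suc m ℕ.* n)) ⟩
    fromℤ (ℤ.- (ℤ.+ (suc m ℕ.* n)))         ≡⟨ fromℤ-neg (ℤ.+ (suc m ℕ.* n)) ⟩
    - ((suc m ℕ.* n) ×ₙ 1#)               ≡⟨ cong -_ (×1-homo-* (suc m) n) ⟩
    - (suc m ×ₙ 1# * n ×ₙ 1#)             ≡⟨ -‿distribˡ-* _ _ ⟩
    - (suc m ×ₙ 1#) * n ×ₙ 1#             ∎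
    where open ≡-Reasoning
  fromℤ-* -[1+ m ] -[1+ n ] = begin
    fromℤ (ℤ.+ (suc m ℕ.* suc n))           ≡⟨ ×1-homo-* (suc m) (suc n) ⟩
    a * b                                 ≡⟨ sym (-‿involutive _) ⟩
    - - (a * b)                           ≡⟨ cong -_ (-‿distribˡ-* a b) ⟩
    - (- a * b)                           ≡⟨ -‿distribʳ-* (- a) b ⟩
    - a * - b                             ∎
    where
      open ≡-Reasoning
      a = suc m ×ₙ 1#
      b = suc n ×ₙ 1#

  almostCommutativeRing : ACR.AlmostCommutativeRing c c
  almostCommutativeRing = ACR.fromCommutativeRing commutativeRing

  fromℤ-homomorphism : ℤ.+-*-rawRing ACR.-Raw-AlmostCommutative⟶ almostCommutativeRing
  fromℤ-homomorphism = record
    { ⟦_⟧ = fromℤ ; +-homo = fromℤ-+ ; *-homo = fromℤ-* ; -‿homo = fromℤ-neg ; 0-homo = refl ; 1-homo = refl }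

  fromℤ-≟ : ∀ i j → Maybe (fromℤ i ≡ fromℤ j)
  fromℤ-≟ i j with i ℤ.≟ j
  ... | yes i≡j = just (cong fromℤ i≡j)
  ... | no _ = nothing

  open import Algebra.Solver.Ring ℤ.+-*-rawRing almostCommutativeRing fromℤ-homomorphism fromℤ-≟ public

  :0 :1 : ∀ {m} → Polynomial m
  :0 = con (ℤ.+ 0)
  :1 = con (ℤ.+ 1)

module FieldOrder {c ℓ : Level} (F : OrderedField c ℓ) where
  open OrderedField F
  open FieldSolver F
  open CommutativeRing commutativeRing using (ring; +-identityˡ; +-identityʳ; +-comm; -‿inverseʳ; *-comm)
  open import Algebra.Properties.Ring ring using (-0#≈0#)
  open IsTotalOrder isTotalOrder public
    using (total; antisym) renaming (refl to ≤-refl; trans to ≤-trans; reflexive to ≤-reflexive)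

  poset : Poset c c ℓ
  poset = record { isPartialOrder = IsTotalOrder.isPartialOrder isTotalOrder }

  module ≤-Reasoning = PosetReasoning poset

  0≤b-a⇒a≤b : ∀ {a b} → 0# ≤ b - a → a ≤ b
  0≤b-a⇒a≤b {a} {b} 0≤b-a =
    subst₂ _≤_ (+-identityˡ a) (solve 2 (λ a b → (b :- a) :+ a := b) refl a b) (+-monoˡ-≤ a 0≤b-a)

  a≤b⇒0≤b-a : ∀ {a b} → a ≤ b → 0# ≤ b - a
  a≤b⇒0≤b-a {a} a≤b = subst (_≤ _) (-‿inverseʳ a) (+-monoˡ-≤ (- a) a≤b)

  ≤-byDifference : ∀ {a b} e → 0# ≤ e → e ≡ b - a → a ≤ b
  ≤-byDifference e 0≤e e≡b-a = 0≤b-a⇒a≤b (subst (0# ≤_) e≡b-a 0≤e)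

  +-monoʳ-≤ : ∀ a {b c} → b ≤ c → a + b ≤ a + c
  +-monoʳ-≤ a {b} {c} b≤c = subst₂ _≤_ (+-comm b a) (+-comm c a) (+-monoˡ-≤ a b≤c)

  +-mono-≤ : ∀ {a b c d} → a ≤ b → c ≤ d → a + c ≤ b + d
  +-mono-≤ a≤b c≤d = ≤-trans (+-monoˡ-≤ _ a≤b) (+-monoʳ-≤ _ c≤d)

  +-nonNeg : ∀ {a b} → 0# ≤ a → 0# ≤ b → 0# ≤ a + b
  +-nonNeg 0≤a 0≤b = subst (_≤ _) (+-identityˡ 0#) (+-mono-≤ 0≤a 0≤b)

  a≤a+b : ∀ {a b} → 0# ≤ b → a ≤ a + b
  a≤a+b {a} {b} 0≤b = subst (_≤ a + b) (+-identityʳ a) (+-monoʳ-≤ a 0≤b)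

  nonNeg-+≡0ʳ : ∀ {a b} → 0# ≤ a → 0# ≤ b → a + b ≡ 0# → b ≡ 0#
  nonNeg-+≡0ʳ {a} {b} 0≤a 0≤b a+b≡0 = antisym (subst (b ≤_) (trans (+-comm b a) a+b≡0) (a≤a+b 0≤a)) 0≤b

  neg-mono-≤ : ∀ {a b} → a ≤ b → - b ≤ - a
  neg-mono-≤ {a} {b} a≤b = ≤-byDifference (b - a) (a≤b⇒0≤b-a a≤b) (solve 2 (λ a b → b :- a := (:- a) :- (:- b)) refl a b)

  *-monoʳ-≤-nonNeg : ∀ {a b} c → 0# ≤ c → a ≤ b → a * c ≤ b * c
  *-monoʳ-≤-nonNeg {a} {b} c 0≤c a≤b = ≤-byDifference ((b - a) * c) (*-nonneg (a≤b⇒0≤b-a a≤b) 0≤c)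
    (solve 3 (λ a b c → (b :- a) :* c := b :* c :- a :* c) refl a b c)

  *-monoˡ-≤-nonNeg : ∀ {a b} c → 0# ≤ c → a ≤ b → c * a ≤ c * b
  *-monoˡ-≤-nonNeg {a} {b} c 0≤c a≤b = subst₂ _≤_ (*-comm a c) (*-comm b c) (*-monoʳ-≤-nonNeg c 0≤c a≤b)

  0≤1 : 0# ≤ 1#
  0≤1 with total 0# 1#
  ... | inj₁ 0≤1 = 0≤1
  ... | inj₂ 1≤0 = subst (0# ≤_) (solve 0 ((:- :1) :* (:- :1) := :1) refl) (*-nonneg 0≤-1 0≤-1)
    where
      0≤-1 : 0# ≤ - 1#
      0≤-1 = subst (0# ≤_) (+-identityˡ (- 1#)) (a≤b⇒0≤b-a 1≤0)

  a-b≤c⇒a≤b+c : ∀ {a b c} → a - b ≤ c → a ≤ b + c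
  a-b≤c⇒a≤b+c {a} {b} {c} a-b≤c = ≤-byDifference (c - (a - b)) (a≤b⇒0≤b-a a-b≤c)
    (solve 3 (λ a b c → c :- (a :- b) := (b :+ c) :- a) refl a b c)

  a≤b+c⇒a-b≤c : ∀ {a b c} → a ≤ b + c → a - b ≤ c
  a≤b+c⇒a-b≤c {a} {b} {c} a≤b+c = ≤-byDifference ((b + c) - a) (a≤b⇒0≤b-a a≤b+c)
    (solve 3 (λ a b c → (b :+ c) :- a := c :- (a :- b)) refl a b c)

  a-0≡a : ∀ a → a - 0# ≡ a
  a-0≡a a = trans (cong (a +_) -0#≈0#) (+-identityʳ a)

  a-b≤a : ∀ {a b} → 0# ≤ b → a - b ≤ a
  a-b≤a {a} {b} 0≤b = ≤-byDifference b 0≤b (solve 2 (λ a b → b := a :- (a :- b)) refl a b)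

  <-≤-trans : ∀ {a b c} → a < b → b ≤ c → a < c
  <-≤-trans {a} (a≤b , a≢b) b≤c = ≤-trans a≤b b≤c , λ a≡c → a≢b (antisym a≤b (subst (_ ≤_) (sym a≡c) b≤c))

  positive⇒≢0 : ∀ {a} → 0# < a → ¬ (a ≡ 0#)
  positive⇒≢0 (_ , 0≢a) a≡0 = 0≢a (sym a≡0)

  ⁻¹-nonNeg : ∀ a (a≢0 : ¬ (a ≡ 0#)) → 0# ≤ a → 0# ≤ (a ⁻¹) a≢0
  ⁻¹-nonNeg a a≢0 0≤a with total 0# ((a ⁻¹) a≢0)
  ... | inj₁ 0≤a⁻¹ = 0≤a⁻¹
  ... | inj₂ a⁻¹≤0 = ⊥-elim (0≢1 (antisym 0≤1 1≤0))
    where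
      a⁻¹ = (a ⁻¹) a≢0
      0≤-a⁻¹ : 0# ≤ - a⁻¹
      0≤-a⁻¹ = subst (_≤ - a⁻¹) -0#≈0# (neg-mono-≤ a⁻¹≤0)
      1≤0 : 1# ≤ 0#
      1≤0 = ≤-byDifference (a * - a⁻¹) (*-nonneg 0≤a 0≤-a⁻¹)
        (trans (solve 2 (λ a b → a :* (:- b) := :0 :- a :* b) refl a a⁻¹) (cong (λ x → 0# - x) (⁻¹-inverse a a≢0)))

  min : Carrier → Carrier → Carrier
  min a b with total a b
  ... | inj₁ _ = a
  ... | inj₂ _ = b

  min-≤ˡ : ∀ a b → min a b ≤ a
  min-≤ˡ a b with total a b
  ... | inj₁ _ = ≤-refl
  ... | inj₂ b≤a = b≤a

  min-≤ʳ : ∀ a b → min a b ≤ b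
  min-≤ʳ a b with total a b
  ... | inj₁ a≤b = a≤b
  ... | inj₂ _ = ≤-refl

  min-sel : ∀ a b → min a b ≡ a ⊎ min a b ≡ b
  min-sel a b with total a b
  ... | inj₁ _ = inj₁ refl
  ... | inj₂ _ = inj₂ refl

  min-nonNeg : ∀ {a b} → 0# ≤ a → 0# ≤ b → 0# ≤ min a b
  min-nonNeg {a} {b} 0≤a 0≤b with min-sel a b
  ... | inj₁ min≡a = subst (0# ≤_) (sym min≡a) 0≤a
  ... | inj₂ min≡b = subst (0# ≤_) (sym min≡b) 0≤b

module FiniteSums {c ℓ : Level} (F : OrderedField c ℓ) where
  open OrderedField F
  open FieldSolver F
  open FieldOrder F
  open CommutativeRing commutativeRing
    using (+-commutativeMonoid; semiring; ring; +-identityˡ; +-identityʳ; zeroʳ)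
  open import Algebra.Properties.CommutativeMonoid.Sum +-commutativeMonoid
    using (sum; sum-replicate-zero) renaming (∑-distrib-+ to sum-distrib-+; ∑-comm to sum-comm)
  open import Algebra.Properties.Semiring.Sum semiring using (*-distribˡ-sum)
  open import Algebra.Properties.Ring ring using (-0#≈0#; -‿+-comm)

  ∑ : (k : ℕ) → (Fin k → Carrier) → Carrier
  ∑ = Σ[_] F

  ∑≡sum : ∀ k (f : Fin k → Carrier) → ∑ k f ≡ sum f
  ∑≡sum zero f = refl
  ∑≡sum (suc k) f = cong (f fzero +_) (∑≡sum k (λ i → f (fsuc i)))

  ∑-cong : ∀ k {f g : Fin k → Carrier} → (∀ i → f i ≡ g i) → ∑ k f ≡ ∑ k g
  ∑-cong zero f≗g = refl
  ∑-cong (suc k) f≗g = cong₂ _+_ (f≗g fzero) (∑-cong k (λ i → f≗g (fsuc i)))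

  ∑-distrib-+ : ∀ k (f g : Fin k → Carrier) → ∑ k (λ i → f i + g i) ≡ ∑ k f + ∑ k g
  ∑-distrib-+ k f g rewrite ∑≡sum k (λ i → f i + g i) | ∑≡sum k f | ∑≡sum k g = sum-distrib-+ f g

  ∑-*ˡ : ∀ k a (f : Fin k → Carrier) → ∑ k (λ i → a * f i) ≡ a * ∑ k f
  ∑-*ˡ k a f rewrite ∑≡sum k (λ i → a * f i) | ∑≡sum k f = sym (*-distribˡ-sum a f)

  ∑-zero : ∀ k → ∑ k (λ _ → 0#) ≡ 0#
  ∑-zero k rewrite ∑≡sum k (λ _ → 0#) = sum-replicate-zero k

  ∑-comm : ∀ m n (f : Fin m → Fin n → Carrier) → ∑ m (λ i → ∑ n (f i)) ≡ ∑ n (λ j → ∑ m (λ i → f i j))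
  ∑-comm m n f = begin
    ∑ m (λ i → ∑ n (f i))            ≡⟨ ∑-cong m (λ i → ∑≡sum n (f i)) ⟩
    ∑ m (λ i → sum (f i))            ≡⟨ ∑≡sum m _ ⟩
    sum (λ i → sum (f i))            ≡⟨ sum-comm f ⟩
    sum (λ j → sum (λ i → f i j))    ≡⟨ sym (∑≡sum n _) ⟩
    ∑ n (λ j → sum (λ i → f i j))    ≡⟨ sym (∑-cong n (λ j → ∑≡sum m (λ i → f i j))) ⟩
    ∑ n (λ j → ∑ m (λ i → f i j))    ∎
    where open ≡-Reasoning

  ∑-neg : ∀ k (f : Fin k → Carrier) → ∑ k (λ i → - f i) ≡ - ∑ k f
  ∑-neg zero f = sym -0#≈0#
  ∑-neg (suc k) f = trans (cong (- f fzero +_) (∑-neg k (λ i → f (fsuc i)))) (-‿+-comm _ _)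

  ∑-mono-≤ : ∀ k {f g : Fin k → Carrier} → (∀ i → f i ≤ g i) → ∑ k f ≤ ∑ k g
  ∑-mono-≤ zero f≤g = ≤-refl
  ∑-mono-≤ (suc k) f≤g = +-mono-≤ (f≤g fzero) (∑-mono-≤ k (λ i → f≤g (fsuc i)))

  ∑-nonNeg : ∀ k {f : Fin k → Carrier} → (∀ i → 0# ≤ f i) → 0# ≤ ∑ k f
  ∑-nonNeg k {f} 0≤f = subst (_≤ ∑ k f) (∑-zero k) (∑-mono-≤ k 0≤f)

  ≤-∑ : ∀ k {f : Fin k → Carrier} → (∀ i → 0# ≤ f i) → ∀ i → f i ≤ ∑ k f
  ≤-∑ (suc k) 0≤f fzero = a≤a+b (∑-nonNeg k (λ i → 0≤f (fsuc i)))
  ≤-∑ (suc k) {f} 0≤f (fsuc i) =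
    subst (_≤ ∑ (suc k) f) (+-identityˡ (f (fsuc i))) (+-mono-≤ (0≤f fzero) (≤-∑ k (λ i → 0≤f (fsuc i)) i))

  ite : Bool → Carrier → Carrier
  ite b x = if b then x else 0#

  ∑On : (k : ℕ) → (Fin k → Bool) → (Fin k → Carrier) → Carrier
  ∑On = ΣOn F

  ite-+ : ∀ b x y → ite b (x + y) ≡ ite b x + ite b y
  ite-+ true x y = refl
  ite-+ false x y = sym (+-identityˡ 0#)

  ite-*ˡ : ∀ b a x → ite b (a * x) ≡ a * ite b x
  ite-*ˡ true a x = refl
  ite-*ˡ false a x = sym (zeroʳ a)

  ite-neg : ∀ b x → ite b (- x) ≡ - ite b x
  ite-neg true x = refl
  ite-neg false x = sym -0#≈0#

  ite-cong : ∀ b {x y} → (b ≡ true → x ≡ y) → ite b x ≡ ite b y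
  ite-cong true x≡y = x≡y refl
  ite-cong false x≡y = refl

  ite-nonNeg : ∀ b {x} → (b ≡ true → 0# ≤ x) → 0# ≤ ite b x
  ite-nonNeg true 0≤x = 0≤x refl
  ite-nonNeg false 0≤x = ≤-refl

  ∑On-cong : ∀ k T {f g : Fin k → Carrier} → (∀ i → T i ≡ true → f i ≡ g i) → ∑On k T f ≡ ∑On k T g
  ∑On-cong k T f≗g = ∑-cong k (λ i → ite-cong (T i) (f≗g i))

  ∑On-distrib-+ : ∀ k T (f g : Fin k → Carrier) → ∑On k T (λ i → f i + g i) ≡ ∑On k T f + ∑On k T g
  ∑On-distrib-+ k T f g = trans (∑-cong k (λ i → ite-+ (T i) (f i) (g i))) (∑-distrib-+ k _ _)

  ∑On-*ˡ : ∀ k T a (f : Fin k → Carrier) → ∑On k T (λ i → a * f i) ≡ a * ∑On k T f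
  ∑On-*ˡ k T a f = trans (∑-cong k (λ i → ite-*ˡ (T i) a (f i))) (∑-*ˡ k a _)

  ∑On-neg : ∀ k T (f : Fin k → Carrier) → ∑On k T (λ i → - f i) ≡ - ∑On k T f
  ∑On-neg k T f = trans (∑-cong k (λ i → ite-neg (T i) (f i))) (∑-neg k _)

  ∑On-zero : ∀ k T {f : Fin k → Carrier} → (∀ i → T i ≡ true → f i ≡ 0#) → ∑On k T f ≡ 0#
  ∑On-zero k T f≗0 = trans (∑On-cong k T f≗0) (trans (∑-cong k (λ i → ite-0 (T i))) (∑-zero k))
    where
      ite-0 : ∀ b → ite b 0# ≡ 0#
      ite-0 true = refl
      ite-0 false = refl

  ∑On-nonNeg : ∀ k T {f : Fin k → Carrier} → (∀ i → T i ≡ true → 0# ≤ f i) → 0# ≤ ∑On k T f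
  ∑On-nonNeg k T 0≤f = ∑-nonNeg k (λ i → ite-nonNeg (T i) (0≤f i))

  ≤-∑On : ∀ k T {f : Fin k → Carrier} → (∀ i → T i ≡ true → 0# ≤ f i) → ∀ i → T i ≡ true → f i ≤ ∑On k T f
  ≤-∑On k T {f} 0≤f i Tᵢ = subst (_≤ ∑On k T f) (cong (λ b → ite b (f i)) Tᵢ)
    (≤-∑ k (λ j → ite-nonNeg (T j) (0≤f j)) i)

  ∑-complement : ∀ k T T′ (f : Fin k → Carrier) → (∀ i → T′ i ≡ not (T i)) → ∑ k f ≡ ∑On k T f + ∑On k T′ f
  ∑-complement k T T′ f T′≗notT = trans (∑-cong k (λ i → split (T i) (T′ i) (T′≗notT i))) (∑-distrib-+ k _ _)
    where
      split : ∀ b b′ {x} → b′ ≡ not b → x ≡ ite b x + ite b′ x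
      split true .false refl = sym (+-identityʳ _)
      split false .true refl = sym (+-identityˡ _)

  ∑On-headIn : ∀ k T (f : Fin (suc k) → Carrier) → T fzero ≡ true → ∑On (suc k) T f ≡ f fzero + ∑On k (tail T) (tail f)
  ∑On-headIn k T f T₀ rewrite T₀ = refl

  ∑On-headOut : ∀ k T (f : Fin (suc k) → Carrier) → T fzero ≡ false → ∑On (suc k) T f ≡ ∑On k (tail T) (tail f)
  ∑On-headOut k T f T₀ rewrite T₀ = +-identityˡ _

  deficit : ∀ k → (Fin k → Bool) → (Fin k → Carrier) → Carrier
  deficit k S y = ∑On k S (λ i → 1# - y i)

  deficit≡card-∑On : ∀ k S y → deficit k S y ≡ card F k S - ∑On k S y
  deficit≡card-∑On k S y = trans (∑On-distrib-+ k S (λ _ → 1#) (λ i → - y i)) (cong (card F k S +_) (∑On-neg k S y))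

  conjunctionCut⇔deficit : ∀ k S y z → (∑On k S y - card F k S + 1# ≤ z) ⇔ (1# - z ≤ deficit k S y)
  conjunctionCut⇔deficit k S y z = mk⇔
    (λ cut → subst (1# - z ≤_) (sym (deficit≡card-∑On k S y)) (≤-byDifference _ (a≤b⇒0≤b-a cut)
      (solve 3 (λ z Y C → z :- (Y :- C :+ :1) := (C :- Y) :- (:1 :- z)) refl z Y C)))
    (λ 1-z≤d → ≤-byDifference _ (a≤b⇒0≤b-a (subst (1# - z ≤_) (deficit≡card-∑On k S y) 1-z≤d))
      (solve 3 (λ z Y C → (C :- Y) :- (:1 :- z) := z :- (Y :- C :+ :1)) refl z Y C))
    where
      Y = ∑On k S y
      C = card F k S

Bits : ℕ → Set
Bits = Vector Bool

Intact : ∀ {n} → Bits n → Bits n → Set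
Intact S v = ∀ i → S i ≡ true → v i ≡ true

intact? : ∀ {n} (S v : Bits n) → Dec (Intact S v)
intact? S v = all? (λ i → (S i ≟ true) →-dec (v i ≟ true))

broken-witness : ∀ {n} {S v : Bits n} → ¬ Intact S v → ∃ λ i → S i ≡ true × v i ≡ false
broken-witness {n} {S} {v} ¬intact with ¬∀⟶∃¬ n _ (λ i → (S i ≟ true) →-dec (v i ≟ true)) ¬intact
... | i , ¬Sᵢ⇒vᵢ with S i in Sᵢ | v i in vᵢ
...   | true | true = ⊥-elim (¬Sᵢ⇒vᵢ (λ _ → refl))
...   | true | false = i , Sᵢ , vᵢ
...   | false | _ = ⊥-elim (¬Sᵢ⇒vᵢ (λ ()))

broken-head : ∀ {n} {S : Bits (suc n)} {v : Bits n} → head S ≡ true → ¬ Intact S (false ∷ᵛ v)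
broken-head S₀ intact with intact fzero S₀
... | ()

broken-tail : ∀ {n} {S : Bits (suc n)} {v : Bits n} b → ¬ Intact (tail S) v → ¬ Intact S (b ∷ᵛ v)
broken-tail b ¬intact intact = ¬intact (λ i → intact (fsuc i))

module WeightedLists {c ℓ : Level} (F : OrderedField c ℓ) where
  open OrderedField F
  open FieldSolver F
  open FieldOrder F
  open FiniteSums F using (∑)
  open CommutativeRing commutativeRing using (+-assoc; +-comm; +-identityˡ; +-identityʳ; -‿inverseʳ; *-identityʳ; zeroˡ; zeroʳ)

  ind : Bool → Carrier
  ind true = 1#
  ind false = 0#

  ind-nonNeg : ∀ b → 0# ≤ ind b
  ind-nonNeg true = 0≤1
  ind-nonNeg false = ≤-refl

  ind≤1 : ∀ b → ind b ≤ 1#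
  ind≤1 true = ≤-refl
  ind≤1 false = 0≤1

  Piece : ℕ → Set c
  Piece n = Carrier × Bits n

  NonNeg : ∀ {n} → List (Piece n) → Set (c ⊔ ℓ)
  NonNeg = All (λ p → 0# ≤ proj₁ p)

  wsum : ∀ {n} → (Bits n → Carrier) → List (Piece n) → Carrier
  wsum h [] = 0#
  wsum h ((μ , v) ∷ l) = μ * h v + wsum h l

  mass : ∀ {n} → List (Piece n) → Carrier
  mass = wsum (λ _ → 1#)

  wsum-++ : ∀ {n} h (l l′ : List (Piece n)) → wsum h (l ++ l′) ≡ wsum h l + wsum h l′
  wsum-++ h [] l′ = sym (+-identityˡ _)
  wsum-++ h ((μ , v) ∷ l) l′ = trans (cong (μ * h v +_) (wsum-++ h l l′)) (sym (+-assoc _ _ _))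

  wsum-cong : ∀ {n} {h h′ : Bits n → Carrier} (l : List (Piece n)) → (∀ v → h v ≡ h′ v) → wsum h l ≡ wsum h′ l
  wsum-cong [] h≗h′ = refl
  wsum-cong ((μ , v) ∷ l) h≗h′ = cong₂ (λ x y → μ * x + y) (h≗h′ v) (wsum-cong l h≗h′)

  wsum-zero : ∀ {n} (l : List (Piece n)) → wsum (λ _ → 0#) l ≡ 0#
  wsum-zero [] = refl
  wsum-zero ((μ , v) ∷ l) = trans (cong₂ _+_ (zeroʳ μ) (wsum-zero l)) (+-identityˡ 0#)

  wsum-const : ∀ {n} a (l : List (Piece n)) → wsum (λ _ → a) l ≡ a * mass l
  wsum-const a [] = sym (zeroʳ a)
  wsum-const a ((μ , v) ∷ l) = trans (cong (μ * a +_) (wsum-const a l))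
    (solve 3 (λ μ a m → μ :* a :+ a :* m := a :* (μ :* :1 :+ m)) refl μ a (mass l))

  wsum-*ʳ : ∀ {n} h r (l : List (Piece n)) → wsum (λ v → h v * r) l ≡ wsum h l * r
  wsum-*ʳ h r [] = sym (zeroˡ r)
  wsum-*ʳ h r ((μ , v) ∷ l) = trans (cong (μ * (h v * r) +_) (wsum-*ʳ h r l))
    (solve 4 (λ μ h r s → μ :* (h :* r) :+ s :* r := (μ :* h :+ s) :* r) refl μ (h v) r (wsum h l))

  wsum-mono-≤ : ∀ {n} {h h′ : Bits n → Carrier} {l : List (Piece n)} →
                NonNeg l → All (λ p → h (proj₂ p) ≤ h′ (proj₂ p)) l → wsum h l ≤ wsum h′ l
  wsum-mono-≤ [] [] = ≤-refl
  wsum-mono-≤ (0≤μ ∷ 0≤l) (h≤h′ ∷ l≤) = +-mono-≤ (*-monoˡ-≤-nonNeg _ 0≤μ h≤h′) (wsum-mono-≤ 0≤l l≤)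

  mass-nonNeg : ∀ {n} {l : List (Piece n)} → NonNeg l → 0# ≤ mass l
  mass-nonNeg [] = ≤-refl
  mass-nonNeg {l = (μ , v) ∷ l} (0≤μ ∷ 0≤l) = +-nonNeg (subst (0# ≤_) (sym (*-identityʳ μ)) 0≤μ) (mass-nonNeg 0≤l)

  ∑-lookup : ∀ {n} h (l : List (Piece n)) →
             ∑ (List.length l) (λ j → proj₁ (List.lookup l j) * h (proj₂ (List.lookup l j))) ≡ wsum h l
  ∑-lookup h [] = refl
  ∑-lookup h ((μ , v) ∷ l) = cong (μ * h v +_) (∑-lookup h l)

  -- Spending a budget t greedily along l: takeMass t l gets the first mass t of l and dropMass t l
  -- the rest (both keep every vector, possibly with weight 0); shortfall t l = t - min t (mass l).
  takeMass dropMass : ∀ {n} → Carrier → List (Piece n) → List (Piece n)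
  takeMass t [] = []
  takeMass t ((μ , v) ∷ l) = (min μ t , v) ∷ takeMass (t - min μ t) l
  dropMass t [] = []
  dropMass t ((μ , v) ∷ l) = (μ - min μ t , v) ∷ dropMass (t - min μ t) l

  shortfall : ∀ {n} → Carrier → List (Piece n) → Carrier
  shortfall t [] = t
  shortfall t ((μ , v) ∷ l) = shortfall (t - min μ t) l

  takeMass-dropMass : ∀ {n} h t (l : List (Piece n)) → wsum h (takeMass t l) + wsum h (dropMass t l) ≡ wsum h l
  takeMass-dropMass h t [] = +-identityˡ 0#
  takeMass-dropMass h t ((μ , v) ∷ l) = begin
    (m * h v + wsum h (takeMass t′ l)) + ((μ - m) * h v + wsum h (dropMass t′ l))
      ≡⟨ solve 5 (λ m x μ p q → (m :* x :+ p) :+ ((μ :- m) :* x :+ q) := μ :* x :+ (p :+ q)) refl m (h v) μ _ _ ⟩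
    μ * h v + (wsum h (takeMass t′ l) + wsum h (dropMass t′ l))
      ≡⟨ cong (μ * h v +_) (takeMass-dropMass h t′ l) ⟩
    μ * h v + wsum h l ∎
    where
      open ≡-Reasoning
      m = min μ t
      t′ = t - m

  takeMass-shortfall : ∀ {n} t (l : List (Piece n)) → mass (takeMass t l) + shortfall t l ≡ t
  takeMass-shortfall t [] = +-identityˡ t
  takeMass-shortfall t ((μ , v) ∷ l) = begin
    (m * 1# + mass (takeMass t′ l)) + shortfall t′ l   ≡⟨ +-assoc _ _ _ ⟩
    m * 1# + (mass (takeMass t′ l) + shortfall t′ l)   ≡⟨ cong (m * 1# +_) (takeMass-shortfall t′ l) ⟩
    m * 1# + (t - m)                                   ≡⟨ solve 2 (λ m t → m :* :1 :+ (t :- m) := t) refl m t ⟩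
    t ∎
    where
      open ≡-Reasoning
      m = min μ t
      t′ = t - m

  takeMass-nonNeg : ∀ {n} {t} {l : List (Piece n)} → 0# ≤ t → NonNeg l → NonNeg (takeMass t l)
  takeMass-nonNeg 0≤t [] = []
  takeMass-nonNeg {t = t} {(μ , v) ∷ l} 0≤t (0≤μ ∷ 0≤l) =
    min-nonNeg 0≤μ 0≤t ∷ takeMass-nonNeg (a≤b⇒0≤b-a (min-≤ʳ μ t)) 0≤l

  dropMass-nonNeg : ∀ {n} t (l : List (Piece n)) → NonNeg (dropMass t l)
  dropMass-nonNeg t [] = []
  dropMass-nonNeg t ((μ , v) ∷ l) = a≤b⇒0≤b-a (min-≤ˡ μ t) ∷ dropMass-nonNeg (t - min μ t) l

  shortfall-nonNeg : ∀ {n} {t} (l : List (Piece n)) → 0# ≤ t → 0# ≤ shortfall t l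
  shortfall-nonNeg [] 0≤t = 0≤t
  shortfall-nonNeg {t = t} ((μ , v) ∷ l) 0≤t = shortfall-nonNeg l (a≤b⇒0≤b-a (min-≤ʳ μ t))

  takeMass-All : ∀ {n p} {Q : Bits n → Set p} t {l : List (Piece n)} → All (Q ∘ proj₂) l → All (Q ∘ proj₂) (takeMass t l)
  takeMass-All t [] = []
  takeMass-All t {(μ , v) ∷ l} (q ∷ qs) = q ∷ takeMass-All (t - min μ t) qs

  dropMass-All : ∀ {n p} {Q : Bits n → Set p} t {l : List (Piece n)} → All (Q ∘ proj₂) l → All (Q ∘ proj₂) (dropMass t l)
  dropMass-All t [] = []
  dropMass-All t {(μ , v) ∷ l} (q ∷ qs) = q ∷ dropMass-All (t - min μ t) qs

  takeMass-++ : ∀ {n} t (l l′ : List (Piece n)) → takeMass t (l ++ l′) ≡ takeMass t l ++ takeMass (shortfall t l) l′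
  takeMass-++ t [] l′ = refl
  takeMass-++ t ((μ , v) ∷ l) l′ = cong ((min μ t , v) ∷_) (takeMass-++ (t - min μ t) l l′)

  dropMass-++ : ∀ {n} t (l l′ : List (Piece n)) → dropMass t (l ++ l′) ≡ dropMass t l ++ dropMass (shortfall t l) l′
  dropMass-++ t [] l′ = refl
  dropMass-++ t ((μ , v) ∷ l) l′ = cong ((μ - min μ t , v) ∷_) (dropMass-++ (t - min μ t) l l′)

  mass-takeMass-0 : ∀ {n} {l : List (Piece n)} → NonNeg l → mass (takeMass 0# l) ≡ 0#
  mass-takeMass-0 {l = l} 0≤l = nonNeg-+≡0ʳ (shortfall-nonNeg l ≤-refl) (mass-nonNeg (takeMass-nonNeg ≤-refl 0≤l))
    (trans (+-comm _ _) (takeMass-shortfall 0# l))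

  shortfall-0 : ∀ {n} {l : List (Piece n)} → NonNeg l → shortfall 0# l ≡ 0#
  shortfall-0 {l = l} 0≤l = nonNeg-+≡0ʳ (mass-nonNeg (takeMass-nonNeg ≤-refl 0≤l)) (shortfall-nonNeg l ≤-refl)
    (takeMass-shortfall 0# l)

  dropMass-empty⊎shortfall-0 : ∀ {n} {t} {l : List (Piece n)} → NonNeg l → mass (dropMass t l) ≡ 0# ⊎ shortfall t l ≡ 0#
  dropMass-empty⊎shortfall-0 [] = inj₁ refl
  dropMass-empty⊎shortfall-0 {t = t} {(μ , v) ∷ l} (0≤μ ∷ 0≤l) with min-sel μ t
  ... | inj₂ min≡t rewrite min≡t | -‿inverseʳ t = inj₂ (shortfall-0 0≤l)
  ... | inj₁ min≡μ rewrite min≡μ | -‿inverseʳ μ with dropMass-empty⊎shortfall-0 {t = t - μ} 0≤l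
  ...   | inj₂ spent = inj₂ spent
  ...   | inj₁ empty = inj₁ (trans (cong₂ _+_ (zeroˡ 1#) empty) (+-identityˡ 0#))

  shortfall-0-if-covered : ∀ {n} {t} {l : List (Piece n)} → NonNeg l → 0# ≤ t → t ≤ mass l → shortfall t l ≡ 0#
  shortfall-0-if-covered {t = t} {l} 0≤l 0≤t t≤mass with dropMass-empty⊎shortfall-0 {t = t} 0≤l
  ... | inj₂ spent = spent
  ... | inj₁ empty = antisym (≤-byDifference (taken - t) (a≤b⇒0≤b-a t≤taken) taken-t≡-shortfall) (shortfall-nonNeg l 0≤t)
    where
      taken = mass (takeMass t l)
      t≤taken : t ≤ taken
      t≤taken = subst (t ≤_) (trans (sym (takeMass-dropMass _ t l)) (trans (cong (taken +_) empty) (+-identityʳ _))) t≤mass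
      taken-t≡-shortfall : taken - t ≡ 0# - shortfall t l
      taken-t≡-shortfall = trans (cong (λ x → taken - x) (sym (takeMass-shortfall t l)))
        (solve 2 (λ a s → a :- (a :+ s) := :0 :- s) refl taken (shortfall t l))

  mass-dropMass-if-covered : ∀ {n} {t} {l : List (Piece n)} → NonNeg l → 0# ≤ t → t ≤ mass l →
                             mass (dropMass t l) ≡ mass l - t
  mass-dropMass-if-covered {t = t} {l} 0≤l 0≤t t≤mass = begin
    D                   ≡⟨ solve 3 (λ T D s → D := (T :+ D) :- (T :+ s) :+ s) refl T D s ⟩
    (T + D) - (T + s) + s ≡⟨ cong₂ (λ x y → x - y + s) (takeMass-dropMass _ t l) (takeMass-shortfall t l) ⟩
    mass l - t + s      ≡⟨ cong (mass l - t +_) (shortfall-0-if-covered 0≤l 0≤t t≤mass) ⟩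
    mass l - t + 0#     ≡⟨ +-identityʳ _ ⟩
    mass l - t          ∎
    where
      open ≡-Reasoning
      T = mass (takeMass t l)
      D = mass (dropMass t l)
      s = shortfall t l

  wsum-takeMass-++ : ∀ {n} h t (l l′ : List (Piece n)) →
                     wsum h (takeMass t (l ++ l′)) ≡ wsum h (takeMass t l) + wsum h (takeMass (shortfall t l) l′)
  wsum-takeMass-++ h t l l′ = trans (cong (wsum h) (takeMass-++ t l l′)) (wsum-++ h (takeMass t l) _)

  wsum-dropMass-++ : ∀ {n} h t (l l′ : List (Piece n)) →
                     wsum h (dropMass t (l ++ l′)) ≡ wsum h (dropMass t l) + wsum h (dropMass (shortfall t l) l′)
  wsum-dropMass-++ h t l l′ = trans (cong (wsum h) (dropMass-++ t l l′)) (wsum-++ h (dropMass t l) _)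

  extend : ∀ {n} → Bool → List (Piece n) → List (Piece (suc n))
  extend b = List.map (map₂ (b ∷ᵛ_))

  extendCut : ∀ {n} → Carrier → List (Piece n) → List (Piece (suc n))
  extendCut t l = extend false (takeMass t l) ++ extend true (dropMass t l)

  wsum-extend : ∀ {n} h b (l : List (Piece n)) → wsum h (extend b l) ≡ wsum (λ v → h (b ∷ᵛ v)) l
  wsum-extend h b [] = refl
  wsum-extend h b ((μ , v) ∷ l) = cong (μ * h (b ∷ᵛ v) +_) (wsum-extend h b l)

  wsum-extend-≗ : ∀ {n} {h : Bits (suc n) → Carrier} {h′ : Bits n → Carrier} b (l : List (Piece n)) →
                  (∀ v → h (b ∷ᵛ v) ≡ h′ v) → wsum h (extend b l) ≡ wsum h′ l
  wsum-extend-≗ {h = h} b l h≗h′ = trans (wsum-extend h b l) (wsum-cong l h≗h′)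

  extend-nonNeg : ∀ {n} b {l : List (Piece n)} → NonNeg l → NonNeg (extend b l)
  extend-nonNeg b = All.map⁺

  extendCut-nonNeg : ∀ {n} {t} {l : List (Piece n)} → 0# ≤ t → NonNeg l → NonNeg (extendCut t l)
  extendCut-nonNeg {t = t} {l} 0≤t 0≤l =
    All.++⁺ (extend-nonNeg false (takeMass-nonNeg 0≤t 0≤l)) (extend-nonNeg true (dropMass-nonNeg t l))

  wsum-extendCut : ∀ {n} {h : Bits (suc n) → Carrier} {h′ : Bits n → Carrier} t (l : List (Piece n)) →
                   (∀ b v → h (b ∷ᵛ v) ≡ h′ v) → wsum h (extendCut t l) ≡ wsum h′ l
  wsum-extendCut {h = h} {h′} t l h≗h′ = begin
    wsum h (extendCut t l)                               ≡⟨ wsum-++ h (extend false (takeMass t l)) _ ⟩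
    wsum h (extend false (takeMass t l)) + wsum h (extend true (dropMass t l))
      ≡⟨ cong₂ _+_ (wsum-extend-≗ false (takeMass t l) (h≗h′ false)) (wsum-extend-≗ true (dropMass t l) (h≗h′ true)) ⟩
    wsum h′ (takeMass t l) + wsum h′ (dropMass t l)      ≡⟨ takeMass-dropMass h′ t l ⟩
    wsum h′ l                                            ∎
    where open ≡-Reasoning

  wsum-head-extendFalse : ∀ {n} (l : List (Piece n)) → wsum (ind ∘ head) (extend false l) ≡ 0#
  wsum-head-extendFalse l = trans (wsum-extend (ind ∘ head) false l) (wsum-zero l)

  wsum-head-extendCut : ∀ {n} t (l : List (Piece n)) → wsum (ind ∘ head) (extendCut t l) ≡ mass (dropMass t l)
  wsum-head-extendCut t l = begin
    wsum (ind ∘ head) (extendCut t l)   ≡⟨ wsum-++ (ind ∘ head) (extend false (takeMass t l)) _ ⟩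
    wsum (ind ∘ head) (extend false (takeMass t l)) + wsum (ind ∘ head) (extend true (dropMass t l))
      ≡⟨ cong₂ _+_ (wsum-head-extendFalse (takeMass t l)) (wsum-extend (ind ∘ head) true (dropMass t l)) ⟩
    0# + mass (dropMass t l)            ≡⟨ +-identityˡ _ ⟩
    mass (dropMass t l)                 ∎
    where open ≡-Reasoning

module Coupling {c ℓ : Level} (F : OrderedField c ℓ) where
  open OrderedField F
  open FieldSolver F
  open FieldOrder F
  open FiniteSums F
  open WeightedLists F
  open CommutativeRing commutativeRing using (+-identityˡ; +-identityʳ)

  -- Weighted bit vectors, sorted by which of two index sets S₁, S₂ they break.
  record State (n : ℕ) : Set c where
    constructor state
    field
      both only₁ only₂ none : List (Piece n)
  open State public

  Wt : ∀ {n} → (Bits n → Carrier) → State n → Carrier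
  Wt h s = wsum h (both s) + (wsum h (only₁ s) + (wsum h (only₂ s) + wsum h (none s)))

  pieces : ∀ {n} → State n → List (Piece n)
  pieces s = both s ++ (only₁ s ++ (only₂ s ++ none s))

  wsum-pieces : ∀ {n} h (s : State n) → wsum h (pieces s) ≡ Wt h s
  wsum-pieces h s = trans (wsum-++ h (both s) _) (cong (wsum h (both s) +_)
    (trans (wsum-++ h (only₁ s) _) (cong (wsum h (only₁ s) +_) (wsum-++ h (only₂ s) (none s)))))

  AllBroken : ∀ {n} → Bits n → List (Piece n) → Set c
  AllBroken S = All (λ p → ¬ Intact S (proj₂ p))

  record IsCoupling {n} (S₁ S₂ : Bits n) (y : Vector Carrier n) (s : State n) : Set (c ⊔ ℓ) where
    field
      both≥0 : NonNeg (both s)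
      only₁≥0 : NonNeg (only₁ s)
      only₂≥0 : NonNeg (only₂ s)
      none≥0 : NonNeg (none s)
      total-mass : Wt (λ _ → 1#) s ≡ 1#
      marginal : ∀ i → Wt (λ v → ind (v i)) s ≡ y i
      both-broken₁ : AllBroken S₁ (both s)
      both-broken₂ : AllBroken S₂ (both s)
      only₁-broken : AllBroken S₁ (only₁ s)
      only₂-broken : AllBroken S₂ (only₂ s)
      nested : mass (only₁ s) ≡ 0# ⊎ mass (only₂ s) ≡ 0#
      covers₁ : ∀ t → t ≤ 1# → t ≤ deficit n S₁ y → t ≤ mass (both s) + mass (only₁ s)
      covers₂ : ∀ t → t ≤ 1# → t ≤ deficit n S₂ y → t ≤ mass (both s) + mass (only₂ s)

  pieces-nonNeg : ∀ {n} {S₁ S₂ : Bits n} {y} {s} → IsCoupling S₁ S₂ y s → NonNeg (pieces s)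
  pieces-nonNeg C = All.++⁺ both≥0 (All.++⁺ only₁≥0 (All.++⁺ only₂≥0 none≥0))
    where open IsCoupling C

  initial : State 0
  initial = state [] [] [] ((1# , λ ()) ∷ [])

  initial-isCoupling : (S₁ S₂ : Bits 0) (y : Vector Carrier 0) → IsCoupling S₁ S₂ y initial
  initial-isCoupling S₁ S₂ y = record
    { both≥0 = [] ; only₁≥0 = [] ; only₂≥0 = [] ; none≥0 = 0≤1 ∷ []
    ; total-mass = solve 0 (:0 :+ (:0 :+ (:0 :+ (:1 :* :1 :+ :0))) := :1) refl
    ; marginal = λ ()
    ; both-broken₁ = [] ; both-broken₂ = [] ; only₁-broken = [] ; only₂-broken = []
    ; nested = inj₁ refl
    ; covers₁ = λ t _ t≤0 → subst (t ≤_) (sym (+-identityˡ 0#)) t≤0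
    ; covers₂ = λ t _ t≤0 → subst (t ≤_) (sym (+-identityˡ 0#)) t≤0
    }

  swap : ∀ {n} → State n → State n
  swap s = state (both s) (only₂ s) (only₁ s) (none s)

  Wt-swap : ∀ {n} h (s : State n) → Wt h (swap s) ≡ Wt h s
  Wt-swap h s = solve 4 (λ a b c d → a :+ (c :+ (b :+ d)) := a :+ (b :+ (c :+ d))) refl
    (wsum h (both s)) (wsum h (only₁ s)) (wsum h (only₂ s)) (wsum h (none s))

  swap-isCoupling : ∀ {n} {S₁ S₂ : Bits n} {y} {s} → IsCoupling S₁ S₂ y s → IsCoupling S₂ S₁ y (swap s)
  swap-isCoupling {s = s} C = record
    { both≥0 = both≥0 ; only₁≥0 = only₂≥0 ; only₂≥0 = only₁≥0 ; none≥0 = none≥0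
    ; total-mass = trans (Wt-swap _ s) total-mass
    ; marginal = λ i → trans (Wt-swap _ s) (marginal i)
    ; both-broken₁ = both-broken₂ ; both-broken₂ = both-broken₁
    ; only₁-broken = only₂-broken ; only₂-broken = only₁-broken
    ; nested = Sum.swap nested
    ; covers₁ = covers₂ ; covers₂ = covers₁
    }
    where open IsCoupling C

  extend-broken : ∀ {n} {S : Bits (suc n)} b {l : List (Piece n)} → AllBroken (tail S) l → AllBroken S (extend b l)
  extend-broken b [] = []
  extend-broken b (¬intact ∷ ps) = broken-tail b ¬intact ∷ extend-broken b ps

  extendFalse-broken : ∀ {n} {S : Bits (suc n)} → head S ≡ true → (l : List (Piece n)) → AllBroken S (extend false l)
  extendFalse-broken S₀ [] = []
  extendFalse-broken S₀ (_ ∷ l) = broken-head S₀ ∷ extendFalse-broken S₀ l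

  extendCut-broken : ∀ {n} {S : Bits (suc n)} t {l : List (Piece n)} → AllBroken (tail S) l → AllBroken S (extendCut t l)
  extendCut-broken t bs = All.++⁺ (extend-broken false (takeMass-All t bs)) (extend-broken true (dropMass-All t bs))

  -- The new coordinate is set to 0 on a mass t, taken from only₂, none, both, only₁ in this order:
  -- pieces still intact on S₁ are broken first, those already broken on S₂ before the others,
  -- so that the pieces broken on S₁ and those broken on S₂ stay nested.
  module Step {n} (t : Carrier) (s : State n) where
    r₁ r₂ r₃ : Carrier
    r₁ = shortfall t (only₂ s)
    r₂ = shortfall r₁ (none s)
    r₃ = shortfall r₂ (both s)

    next : State (suc n)
    next = state (extend false (takeMass t (only₂ s)) ++ extendCut r₂ (both s))
                 (extend false (takeMass r₁ (none s)) ++ extendCut r₃ (only₁ s))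
                 (extend true (dropMass t (only₂ s)))
                 (extend true (dropMass r₁ (none s)))

  module StepIsCoupling {n} {S₁ S₂ : Bits (suc n)} {y : Vector Carrier (suc n)} {s : State n}
                        (C : IsCoupling (tail S₁) (tail S₂) (tail y) s)
                        (S₁₀ : head S₁ ≡ true) (S₂₀ : head S₂ ≡ false)
                        (0≤y₀ : 0# ≤ head y) (y₀≤1 : head y ≤ 1#) where
    open IsCoupling C
    t : Carrier
    t = 1# - head y
    open Step t s

    0≤t : 0# ≤ t
    0≤t = a≤b⇒0≤b-a y₀≤1

    t≤1 : t ≤ 1#
    t≤1 = a-b≤a 0≤y₀

    0≤r₁ : 0# ≤ r₁
    0≤r₁ = shortfall-nonNeg (only₂ s) 0≤t

    B O₁ O₂ O₀ T₂ D₂ Tₙ : Carrier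
    B = mass (both s)
    O₁ = mass (only₁ s)
    O₂ = mass (only₂ s)
    O₀ = mass (none s)
    T₂ = mass (takeMass t (only₂ s))
    D₂ = mass (dropMass t (only₂ s))
    Tₙ = mass (takeMass r₁ (none s))

    module _ {h : Bits (suc n) → Carrier} {h′ : Bits n → Carrier} (h≗h′ : ∀ b v → h (b ∷ᵛ v) ≡ h′ v) where
      wsum-both-next : wsum h (both next) ≡ wsum h′ (takeMass t (only₂ s)) + wsum h′ (both s)
      wsum-both-next = trans (wsum-++ h (extend false (takeMass t (only₂ s))) _)
        (cong₂ _+_ (wsum-extend-≗ false (takeMass t (only₂ s)) (h≗h′ false)) (wsum-extendCut r₂ (both s) h≗h′))

      wsum-only₁-next : wsum h (only₁ next) ≡ wsum h′ (takeMass r₁ (none s)) + wsum h′ (only₁ s)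
      wsum-only₁-next = trans (wsum-++ h (extend false (takeMass r₁ (none s))) _)
        (cong₂ _+_ (wsum-extend-≗ false (takeMass r₁ (none s)) (h≗h′ false)) (wsum-extendCut r₃ (only₁ s) h≗h′))

      wsum-only₂-next : wsum h (only₂ next) ≡ wsum h′ (dropMass t (only₂ s))
      wsum-only₂-next = wsum-extend-≗ true (dropMass t (only₂ s)) (h≗h′ true)

      wsum-none-next : wsum h (none next) ≡ wsum h′ (dropMass r₁ (none s))
      wsum-none-next = wsum-extend-≗ true (dropMass r₁ (none s)) (h≗h′ true)

      Wt-next : Wt h next ≡ Wt h′ s
      Wt-next = begin
        Wt h next
          ≡⟨ cong₂ _+_ wsum-both-next (cong₂ _+_ wsum-only₁-next (cong₂ _+_ wsum-only₂-next wsum-none-next)) ⟩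
        (g₂ + b) + ((gₙ + o₁) + (d₂ + dₙ))
          ≡⟨ solve 6 (λ g₂ b gₙ o₁ d₂ dₙ → (g₂ :+ b) :+ ((gₙ :+ o₁) :+ (d₂ :+ dₙ))
                                        := b :+ (o₁ :+ ((g₂ :+ d₂) :+ (gₙ :+ dₙ)))) refl g₂ b gₙ o₁ d₂ dₙ ⟩
        b + (o₁ + ((g₂ + d₂) + (gₙ + dₙ)))
          ≡⟨ cong (λ x → b + (o₁ + x))
                  (cong₂ _+_ (takeMass-dropMass h′ t (only₂ s)) (takeMass-dropMass h′ r₁ (none s))) ⟩
        Wt h′ s ∎
        where
          open ≡-Reasoning
          b = wsum h′ (both s)
          o₁ = wsum h′ (only₁ s)
          g₂ = wsum h′ (takeMass t (only₂ s))
          d₂ = wsum h′ (dropMass t (only₂ s))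
          gₙ = wsum h′ (takeMass r₁ (none s))
          dₙ = wsum h′ (dropMass r₁ (none s))

    mass-both-next : mass (both next) ≡ T₂ + B
    mass-both-next = wsum-both-next (λ _ _ → refl)

    mass-only₁-next : mass (only₁ next) ≡ Tₙ + O₁
    mass-only₁-next = wsum-only₁-next (λ _ _ → refl)

    mass-only₂-next : mass (only₂ next) ≡ D₂
    mass-only₂-next = wsum-only₂-next (λ _ _ → refl)

    -- The new coordinate is 1 exactly on the pieces of dropMass t walk.
    walk : List (Piece n)
    walk = only₂ s ++ (none s ++ (both s ++ only₁ s))

    walk≥0 : NonNeg walk
    walk≥0 = All.++⁺ only₂≥0 (All.++⁺ none≥0 (All.++⁺ both≥0 only₁≥0))

    mass-walk : mass walk ≡ 1#
    mass-walk = begin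
      mass walk
        ≡⟨ trans (wsum-++ _ (only₂ s) _) (cong (O₂ +_) (trans (wsum-++ _ (none s) _) (cong (O₀ +_) (wsum-++ _ (both s) _)))) ⟩
      O₂ + (O₀ + (B + O₁))
        ≡⟨ solve 4 (λ b o₁ o₂ n → o₂ :+ (n :+ (b :+ o₁)) := b :+ (o₁ :+ (o₂ :+ n))) refl B O₁ O₂ O₀ ⟩
      Wt (λ _ → 1#) s       ≡⟨ total-mass ⟩
      1#                    ∎
      where open ≡-Reasoning

    marginal₀ : Wt (ind ∘ head) next ≡ head y
    marginal₀ = begin
      Wt (ind ∘ head) next
        ≡⟨ cong₂ _+_ (trans (wsum-++ _ (extend false (takeMass t (only₂ s))) _)
                            (cong₂ _+_ (wsum-head-extendFalse (takeMass t (only₂ s))) (wsum-head-extendCut r₂ (both s))))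
                     (cong₂ _+_ (trans (wsum-++ _ (extend false (takeMass r₁ (none s))) _)
                                       (cong₂ _+_ (wsum-head-extendFalse (takeMass r₁ (none s))) (wsum-head-extendCut r₃ (only₁ s))))
                                (cong₂ _+_ (wsum-extend (ind ∘ head) true (dropMass t (only₂ s)))
                                           (wsum-extend (ind ∘ head) true (dropMass r₁ (none s))))) ⟩
      (0# + d) + ((0# + d₁) + (D₂ + Dₙ))
        ≡⟨ solve 4 (λ d d₁ d₂ dₙ → (:0 :+ d) :+ ((:0 :+ d₁) :+ (d₂ :+ dₙ)) := d₂ :+ (dₙ :+ (d :+ d₁)))
                   refl d d₁ D₂ Dₙ ⟩
      D₂ + (Dₙ + (d + d₁))
        ≡⟨ sym (trans (wsum-dropMass-++ _ t (only₂ s) _) (cong (D₂ +_)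
                 (trans (wsum-dropMass-++ _ r₁ (none s) _) (cong (Dₙ +_) (wsum-dropMass-++ _ r₂ (both s) (only₁ s)))))) ⟩
      mass (dropMass t walk)
        ≡⟨ mass-dropMass-if-covered walk≥0 0≤t (subst (t ≤_) (sym mass-walk) t≤1) ⟩
      mass walk - t         ≡⟨ cong (_- t) mass-walk ⟩
      1# - t                ≡⟨ solve 1 (λ y → :1 :- (:1 :- y) := y) refl (head y) ⟩
      head y                ∎
      where
        open ≡-Reasoning
        d = mass (dropMass r₂ (both s))
        d₁ = mass (dropMass r₃ (only₁ s))
        Dₙ = mass (dropMass r₁ (none s))

    marginal′ : ∀ i → Wt (λ v → ind (v i)) next ≡ y i
    marginal′ fzero = marginal₀
    marginal′ (fsuc i) = trans (Wt-next (λ _ _ → refl)) (marginal i)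

    covers₁′ : ∀ τ → τ ≤ 1# → τ ≤ deficit (suc n) S₁ y → τ ≤ mass (both next) + mass (only₁ next)
    covers₁′ τ τ≤1 τ≤deficit = subst (τ ≤_) (sym broken₁-next) (covers (dropMass-empty⊎shortfall-0 {t = t} pre≥0))
      where
        pre = only₂ s ++ none s
        pre≥0 : NonNeg pre
        pre≥0 = All.++⁺ only₂≥0 none≥0
        taken = mass (takeMass t pre)

        broken₁-next : mass (both next) + mass (only₁ next) ≡ taken + (B + O₁)
        broken₁-next = trans (cong₂ _+_ mass-both-next mass-only₁-next)
          (trans (solve 4 (λ t₂ b tₙ o₁ → (t₂ :+ b) :+ (tₙ :+ o₁) := (t₂ :+ tₙ) :+ (b :+ o₁)) refl T₂ B Tₙ O₁)
                 (cong (_+ (B + O₁)) (sym (wsum-takeMass-++ _ t (only₂ s) (none s)))))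

        -- Either all of t is spent on pieces still intact on S₁, or all of these get broken.
        covers : mass (dropMass t pre) ≡ 0# ⊎ shortfall t pre ≡ 0# → τ ≤ taken + (B + O₁)
        covers (inj₂ spent) = subst (λ x → τ ≤ x + (B + O₁)) (sym taken≡t)
          (a-b≤c⇒a≤b+c (covers₁ (τ - t) (≤-trans (a-b≤a 0≤t) τ≤1)
                                 (a≤b+c⇒a-b≤c (subst (τ ≤_) (∑On-headIn n S₁ (λ i → 1# - y i) S₁₀) τ≤deficit))))
          where
            taken≡t : taken ≡ t
            taken≡t = trans (sym (+-identityʳ taken)) (trans (cong (taken +_) (sym spent)) (takeMass-shortfall t pre))
        covers (inj₁ emptied) = subst (τ ≤_) (sym all-broken) τ≤1
          where
            taken≡pre : taken ≡ O₂ + O₀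
            taken≡pre = trans (sym (+-identityʳ taken)) (trans (cong (taken +_) (sym emptied))
                          (trans (takeMass-dropMass _ t pre) (wsum-++ _ (only₂ s) (none s))))
            all-broken : taken + (B + O₁) ≡ 1#
            all-broken = trans (cong (_+ (B + O₁)) taken≡pre)
              (trans (solve 4 (λ b o₁ o₂ n → (o₂ :+ n) :+ (b :+ o₁) := b :+ (o₁ :+ (o₂ :+ n))) refl B O₁ O₂ O₀)
                     total-mass)

    covers₂′ : ∀ τ → τ ≤ 1# → τ ≤ deficit (suc n) S₂ y → τ ≤ mass (both next) + mass (only₂ next)
    covers₂′ τ τ≤1 τ≤deficit =
      subst (τ ≤_) (sym broken₂-next)
        (covers₂ τ τ≤1 (subst (τ ≤_) (∑On-headOut n S₂ (λ i → 1# - y i) S₂₀) τ≤deficit))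
      where
        broken₂-next : mass (both next) + mass (only₂ next) ≡ B + O₂
        broken₂-next = trans (cong₂ _+_ mass-both-next mass-only₂-next)
          (trans (solve 3 (λ t₂ b d₂ → (t₂ :+ b) :+ d₂ := b :+ (t₂ :+ d₂)) refl T₂ B D₂)
                 (cong (B +_) (takeMass-dropMass _ t (only₂ s))))

    nested′ : mass (only₁ next) ≡ 0# ⊎ mass (only₂ next) ≡ 0#
    nested′ with nested | dropMass-empty⊎shortfall-0 {t = t} only₂≥0
    ... | inj₂ O₂≡0 | _ = inj₂ (trans mass-only₂-next
            (nonNeg-+≡0ʳ (mass-nonNeg (takeMass-nonNeg 0≤t only₂≥0)) (mass-nonNeg (dropMass-nonNeg t (only₂ s)))
                         (trans (takeMass-dropMass _ t (only₂ s)) O₂≡0)))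
    ... | inj₁ _ | inj₁ D₂≡0 = inj₂ (trans mass-only₂-next D₂≡0)
    ... | inj₁ O₁≡0 | inj₂ r₁≡0 = inj₁ (trans mass-only₁-next (trans (cong₂ _+_ Tₙ≡0 O₁≡0) (+-identityˡ 0#)))
      where
        Tₙ≡0 : Tₙ ≡ 0#
        Tₙ≡0 = trans (cong (λ r → mass (takeMass r (none s))) r₁≡0) (mass-takeMass-0 none≥0)

    isCoupling : IsCoupling S₁ S₂ y next
    isCoupling = record
      { both≥0 = All.++⁺ (extend-nonNeg false (takeMass-nonNeg 0≤t only₂≥0)) (extendCut-nonNeg 0≤r₂ both≥0)
      ; only₁≥0 = All.++⁺ (extend-nonNeg false (takeMass-nonNeg 0≤r₁ none≥0))
                          (extendCut-nonNeg (shortfall-nonNeg (both s) 0≤r₂) only₁≥0)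
      ; only₂≥0 = extend-nonNeg true (dropMass-nonNeg t (only₂ s))
      ; none≥0 = extend-nonNeg true (dropMass-nonNeg r₁ (none s))
      ; total-mass = trans (Wt-next (λ _ _ → refl)) total-mass
      ; marginal = marginal′
      ; both-broken₁ = All.++⁺ (extendFalse-broken S₁₀ (takeMass t (only₂ s))) (extendCut-broken r₂ both-broken₁)
      ; both-broken₂ = All.++⁺ (extend-broken false (takeMass-All t only₂-broken)) (extendCut-broken r₂ both-broken₂)
      ; only₁-broken = All.++⁺ (extendFalse-broken S₁₀ (takeMass r₁ (none s))) (extendCut-broken r₃ only₁-broken)
      ; only₂-broken = extend-broken true (dropMass-All t only₂-broken)
      ; nested = nested′
      ; covers₁ = covers₁′
      ; covers₂ = covers₂′
      }
      where
        0≤r₂ : 0# ≤ r₂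
        0≤r₂ = shortfall-nonNeg (none s) 0≤r₁

  step : ∀ {n} → Bool → Carrier → State n → State (suc n)
  step true t s = Step.next t s
  step false t s = swap (Step.next t (swap s))

  step-isCoupling : ∀ {n} {S₁ S₂ : Bits (suc n)} {y : Vector Carrier (suc n)} {s : State n} →
                    IsCoupling (tail S₁) (tail S₂) (tail y) s → head S₂ ≡ not (head S₁) →
                    0# ≤ head y → head y ≤ 1# → IsCoupling S₁ S₂ y (step (head S₁) (1# - head y) s)
  step-isCoupling {S₁ = S₁} C S₂₀≡¬S₁₀ 0≤y₀ y₀≤1 with head S₁ in S₁₀
  ... | true = StepIsCoupling.isCoupling C S₁₀ S₂₀≡¬S₁₀ 0≤y₀ y₀≤1
  ... | false = swap-isCoupling (StepIsCoupling.isCoupling (swap-isCoupling C) S₂₀≡¬S₁₀ S₁₀ 0≤y₀ y₀≤1)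

  build : ∀ n → Bits n → Vector Carrier n → State n
  build zero S y = initial
  build (suc n) S y = step (head S) (1# - head y) (build n (tail S) (tail y))

  build-isCoupling : ∀ n (S₁ S₂ : Bits n) (y : Vector Carrier n) → (∀ i → S₂ i ≡ not (S₁ i)) →
                     (∀ i → (0# ≤ y i) × (y i ≤ 1#)) → IsCoupling S₁ S₂ y (build n S₁ y)
  build-isCoupling zero S₁ S₂ y _ _ = initial-isCoupling S₁ S₂ y
  build-isCoupling (suc n) S₁ S₂ y S₂≡¬S₁ 0≤y≤1 =
    step-isCoupling (build-isCoupling n (tail S₁) (tail S₂) (tail y) (S₂≡¬S₁ ∘ fsuc) (0≤y≤1 ∘ fsuc))
                    (S₂≡¬S₁ fzero) (proj₁ (0≤y≤1 fzero)) (proj₂ (0≤y≤1 fzero))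

module ConvexCombinations {c ℓ : Level} (F : OrderedField c ℓ) where
  open OrderedField F
  open FieldSolver F
  open FieldOrder F
  open FiniteSums F
  open CommutativeRing commutativeRing using (*-comm; *-identityʳ; distribˡ)

  module Average {N : ℕ} (λs : Fin N → Carrier) (λs≥0 : ∀ j → 0# ≤ λs j) (Σλs≡1 : ∑ N λs ≡ 1#) where

    average : (Fin N → Carrier) → Carrier
    average f = ∑ N (λ j → λs j * f j)

    Averages : (Fin N → Carrier) → Carrier → Set c
    Averages f x = average f ≡ x

    averages-const : ∀ a → Averages (λ _ → a) a
    averages-const a =
      trans (∑-cong N (λ j → *-comm (λs j) a)) (trans (∑-*ˡ N a λs) (trans (cong (a *_) Σλs≡1) (*-identityʳ a)))

    averages-cong : ∀ {f g x} → (∀ j → f j ≡ g j) → Averages f x → Averages g x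
    averages-cong f≗g avg = trans (∑-cong N (λ j → cong (λs j *_) (sym (f≗g j)))) avg

    averages-+ : ∀ {f g x y} → Averages f x → Averages g y → Averages (λ j → f j + g j) (x + y)
    averages-+ {f} {g} avg-f avg-g =
      trans (∑-cong N (λ j → distribˡ (λs j) (f j) (g j))) (trans (∑-distrib-+ N _ _) (cong₂ _+_ avg-f avg-g))

    averages-neg : ∀ {f x} → Averages f x → Averages (λ j → - f j) (- x)
    averages-neg {f} avg-f = trans (∑-cong N (λ j → solve 2 (λ l f → l :* (:- f) := :- (l :* f)) refl (λs j) (f j)))
      (trans (∑-neg N _) (cong -_ avg-f))

    averages-*ˡ : ∀ a {f x} → Averages f x → Averages (λ j → a * f j) (a * x)
    averages-*ˡ a {f} avg-f = trans (∑-cong N (λ j → solve 3 (λ l a f → l :* (a :* f) := a :* (l :* f)) refl (λs j) a (f j)))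
      (trans (∑-*ˡ N a _) (cong (a *_) avg-f))

    averages-∑On : ∀ {k} T {g : Fin N → Fin k → Carrier} {x : Fin k → Carrier} →
                   (∀ i → Averages (λ j → g j i) (x i)) → Averages (λ j → ∑On k T (g j)) (∑On k T x)
    averages-∑On {k} T {g} {x} avg = begin
      ∑ N (λ j → λs j * ∑On k T (g j))              ≡⟨ ∑-cong N (λ j → sym (∑On-*ˡ k T (λs j) (g j))) ⟩
      ∑ N (λ j → ∑On k T (λ i → λs j * g j i))      ≡⟨ ∑-comm N k _ ⟩
      ∑ k (λ i → ∑ N (λ j → ite (T i) (λs j * g j i))) ≡⟨ ∑-cong k (λ i → restrict (T i) i) ⟩
      ∑On k T x                                      ∎
      where
        open ≡-Reasoning
        restrict : ∀ b i → ∑ N (λ j → ite b (λs j * g j i)) ≡ ite b (x i)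
        restrict true i = avg i
        restrict false i = ∑-zero N

    averages-≤ : ∀ {f g x y} → (∀ j → f j ≤ g j) → Averages f x → Averages g y → x ≤ y
    averages-≤ {f} {g} f≤g avg-f avg-g =
      subst₂ _≤_ avg-f avg-g (∑-mono-≤ N (λ j → *-monoˡ-≤-nonNeg (λs j) (λs≥0 j) (f≤g j)))

module Sharpness {c ℓ : Level} (F : OrderedField c ℓ) where
  open OrderedField F
  open FieldSolver F
  open FieldOrder F
  open FiniteSums F
  open WeightedLists F
  open ConvexCombinations F
  open CommutativeRing commutativeRing using (ring; +-comm; +-identityʳ; -‿inverseʳ; *-identityʳ)
  open import Algebra.Properties.Ring ring using (-‿distribˡ-*; -‿distribʳ-*)

  AbsLe-weaken : ∀ {x a b} → AbsLe F x a → a ≤ b → AbsLe F x b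
  AbsLe-weaken (x≤a , -x≤a) a≤b = ≤-trans x≤a a≤b , ≤-trans -x≤a a≤b

  AbsLe-scale : ∀ {β r} → 0# ≤ β → AbsLe F r 1# → AbsLe F (β * r) β
  AbsLe-scale {β} {r} 0≤β (r≤1 , -r≤1) =
      subst₂ _≤_ refl (*-identityʳ β) (*-monoˡ-≤-nonNeg β 0≤β r≤1)
    , subst₂ _≤_ (sym (-‿distribʳ-* β r)) (*-identityʳ β) (*-monoˡ-≤-nonNeg β 0≤β -r≤1)

  AbsLe-normalise : ∀ {x a} (a≢0 : ¬ (a ≡ 0#)) → 0# ≤ a → AbsLe F x a → AbsLe F (x * (a ⁻¹) a≢0) 1#
  AbsLe-normalise {x} {a} a≢0 0≤a (x≤a , -x≤a) =
      subst (x * a⁻¹ ≤_) (⁻¹-inverse a a≢0) (*-monoʳ-≤-nonNeg a⁻¹ 0≤a⁻¹ x≤a)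
    , subst₂ _≤_ (sym (-‿distribˡ-* x a⁻¹)) (⁻¹-inverse a a≢0) (*-monoʳ-≤-nonNeg a⁻¹ 0≤a⁻¹ -x≤a)
    where
      a⁻¹ = (a ⁻¹) a≢0
      0≤a⁻¹ = ⁻¹-nonNeg a a≢0 0≤a

  ind-binary : ∀ b → Binary F (ind b)
  ind-binary true = inj₂ refl
  ind-binary false = inj₁ refl

  toBit : ∀ {x} → Binary F x → Bool
  toBit (inj₁ _) = false
  toBit (inj₂ _) = true

  ind-toBit : ∀ {x} (b : Binary F x) → x ≡ ind (toBit b)
  ind-toBit (inj₁ x≡0) = x≡0
  ind-toBit (inj₂ x≡1) = x≡1

  module Formulation (k : ℕ) (w : Fin k → Carrier) (M : Carrier) (L U : Bits k) where
    wL wU : Carrier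
    wL = ∑On k L w
    wU = ∑On k U w

    pathBound : Bits k → Vector Carrier k → Carrier
    pathBound S y = ∑On k S w + ∑On k S (λ i → (M - w i) * (1# - y i))

    boundFromIntact : Bool → Bool → Carrier
    boundFromIntact true _ = wL
    boundFromIntact false true = wU
    boundFromIntact false false = M

    -- for v ∈ {0,1}^C, (δ, v) ∈ R iff |δ| ≤ fibreBound v
    fibreBound : Bits k → Carrier
    fibreBound v = boundFromIntact (does (intact? L v)) (does (intact? U v))

    pathBound-intact : ∀ {S v} {y : Vector Carrier k} → (∀ i → y i ≡ ind (v i)) → Intact S v → pathBound S y ≡ ∑On k S w
    pathBound-intact {S} {v} {y} y≡v intact = trans (cong (∑On k S w +_) (∑On-zero k S no-penalty)) (+-identityʳ _)
      where
        no-penalty : ∀ i → S i ≡ true → (M - w i) * (1# - y i) ≡ 0#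
        no-penalty i Sᵢ = trans (cong (λ x → (M - w i) * (1# - x)) (trans (y≡v i) (cong ind (intact i Sᵢ))))
                                (solve 2 (λ m a → (m :- a) :* (:1 :- :1) := :0) refl M (w i))

    InR⇒≤fibreBound : ∀ {δ y v} → (∀ i → y i ≡ ind (v i)) → InR F k w M L U δ y → AbsLe F δ (fibreBound v)
    InR⇒≤fibreBound {δ} {y} {v} y≡v (_ , δ≤L , δ≤U , δ≤M) = bound (intact? L v) (intact? U v)
      where
        bound : (dL : Dec (Intact L v)) (dU : Dec (Intact U v)) → AbsLe F δ (boundFromIntact (does dL) (does dU))
        bound (yes intactL) _ = subst (AbsLe F δ) (pathBound-intact y≡v intactL) δ≤L
        bound (no _) (yes intactU) = subst (AbsLe F δ) (pathBound-intact y≡v intactU) δ≤U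
        bound (no _) (no _) = δ≤M

    angleBound : Carrier → Carrier → Carrier
    angleBound zl ζ = wL * zl + wU * ζ + M * (1# - zl - ζ)

    -- z̲, z̄, ζ̄ at the lift of a binary point
    zlᵇ zuᵇ ζᵇ : Bits k → Carrier
    zlᵇ v = ind (does (intact? L v))
    zuᵇ v = ind (does (intact? U v))
    ζᵇ v = ind (does (intact? U v) ∧ not (does (intact? L v)))

    ζ≤1-zl : ∀ a b → ind (b ∧ not a) ≤ 1# - ind a
    ζ≤1-zl true true = ≤-reflexive (sym (-‿inverseʳ 1#))
    ζ≤1-zl true false = ≤-reflexive (sym (-‿inverseʳ 1#))
    ζ≤1-zl false true = ≤-reflexive (sym (a-0≡a 1#))
    ζ≤1-zl false false = subst (0# ≤_) (sym (a-0≡a 1#)) 0≤1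

    ζ≤zu : ∀ a b → ind (b ∧ not a) ≤ ind b
    ζ≤zu a true = ind≤1 (not a)
    ζ≤zu a false = ≤-refl

    zu-zl≤ζ : ∀ a b → ind b - ind a ≤ ind (b ∧ not a)
    zu-zl≤ζ true true = ≤-reflexive (-‿inverseʳ 1#)
    zu-zl≤ζ true false = a-b≤a 0≤1
    zu-zl≤ζ false true = ≤-reflexive (a-0≡a 1#)
    zu-zl≤ζ false false = ≤-reflexive (a-0≡a 0#)

    angleBound-boundFromIntact : ∀ a b → angleBound (ind a) (ind (b ∧ not a)) ≡ boundFromIntact a b
    angleBound-boundFromIntact true true = solve 3 (λ a b m → a :* :1 :+ b :* :0 :+ m :* (:1 :- :1 :- :0) := a) refl wL wU M
    angleBound-boundFromIntact true false = solve 3 (λ a b m → a :* :1 :+ b :* :0 :+ m :* (:1 :- :1 :- :0) := a) refl wL wU M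
    angleBound-boundFromIntact false true = solve 3 (λ a b m → a :* :0 :+ b :* :1 :+ m :* (:1 :- :0 :- :1) := b) refl wL wU M
    angleBound-boundFromIntact false false = solve 3 (λ a b m → a :* :0 :+ b :* :0 :+ m :* (:1 :- :0 :- :0) := m) refl wL wU M

    angleBound-lift : ∀ v → angleBound (zlᵇ v) (ζᵇ v) ≡ fibreBound v
    angleBound-lift v = angleBound-boundFromIntact (does (intact? L v)) (does (intact? U v))

    intact≤ : ∀ {S v : Bits k} i → S i ≡ true → ind (does (intact? S v)) ≤ ind (v i)
    intact≤ {S} {v} i Sᵢ = bound (intact? S v)
      where
        bound : (d : Dec (Intact S v)) → ind (does d) ≤ ind (v i)
        bound (yes intact) = ≤-reflexive (cong ind (sym (intact i Sᵢ)))
        bound (no _) = ind-nonNeg (v i)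

    intact-conjunctionCut : ∀ S v → ∑On k S (ind ∘ v) - card F k S + 1# ≤ ind (does (intact? S v))
    intact-conjunctionCut S v = Equivalence.from (conjunctionCut⇔deficit k S (ind ∘ v) (ind (does (intact? S v)))) (bound (intact? S v))
      where
        terms≥0 : ∀ i → S i ≡ true → 0# ≤ 1# - ind (v i)
        terms≥0 i _ = a≤b⇒0≤b-a (ind≤1 (v i))
        bound : (d : Dec (Intact S v)) → 1# - ind (does d) ≤ deficit k S (ind ∘ v)
        bound (yes _) = subst (_≤ deficit k S (ind ∘ v)) (sym (-‿inverseʳ 1#)) (∑On-nonNeg k S terms≥0)
        bound (no broken) with broken-witness broken
        ... | i , Sᵢ , vᵢ = subst (_≤ deficit k S (ind ∘ v)) (cong (λ b → 1# - ind b) vᵢ) (≤-∑On k S terms≥0 i Sᵢ)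

    weightedList⇒InConvR : ∀ {δ y} (ps : List (Piece k)) (g : Bits k → Carrier) → NonNeg ps → mass ps ≡ 1# →
                           (∀ v → InR F k w M L U (g v) (ind ∘ v)) → δ ≡ wsum g ps →
                           (∀ i → y i ≡ wsum (λ v → ind (v i)) ps) → InConvR F k w M L U δ y
    weightedList⇒InConvR ps g ps≥0 mass≡1 g∈R δ≡ y≡ =
        List.length ps , λs , g ∘ vs , (λ j i → ind (vs j i)) , λs≥0 , Σλs≡1 , g∈R ∘ vs
      , trans δ≡ (sym (∑-lookup g ps)) , (λ i → trans (y≡ i) (sym (∑-lookup (λ v → ind (v i)) ps)))
      where
        λs : Fin (List.length ps) → Carrier
        λs j = proj₁ (List.lookup ps j)

        vs : Fin (List.length ps) → Bits k
        vs j = proj₂ (List.lookup ps j)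

        λs≥0 : ∀ j → 0# ≤ λs j
        λs≥0 j = All.lookup ps≥0 (∈-lookup j)

        Σλs≡1 : ∑ (List.length ps) λs ≡ 1#
        Σλs≡1 = trans (∑-cong _ (λ j → sym (*-identityʳ (λs j)))) (trans (∑-lookup (λ _ → 1#) ps) mass≡1)

    hull⊆projection : ∀ {δ y} → InConvR F k w M L U δ y → InProjP F k w M L U δ y
    hull⊆projection {δ} {y} (N , λs , δs , ys , λs≥0 , Σλs≡1 , ys∈R , δ≡ , y≡) =
        average (zlᵇ ∘ vs) , average (zuᵇ ∘ vs) , average (ζᵇ ∘ vs)
      , (λ i Lᵢ → averages-≤ (λ j → intact≤ i Lᵢ) refl (y-average i))
      , averages-≤ (λ j → intact-conjunctionCut L (vs j)) (cut-average L) refl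
      , (λ i Uᵢ → averages-≤ (λ j → intact≤ i Uᵢ) refl (y-average i))
      , averages-≤ (λ j → intact-conjunctionCut U (vs j)) (cut-average U) refl
      , averages-≤ (λ j → ind-nonNeg (intactU j ∧ not (intactL j))) (averages-const 0#) refl
      , averages-≤ (λ j → ζ≤zu (intactL j) (intactU j)) refl refl
      , averages-≤ (λ j → ζ≤1-zl (intactL j) (intactU j)) refl (averages-+ (averages-const 1#) (averages-neg refl))
      , averages-≤ (λ j → zu-zl≤ζ (intactL j) (intactU j)) (averages-+ refl (averages-neg refl)) refl
      , ( averages-≤ (λ j → proj₁ (δs-bound j)) (sym δ≡) angle-average
        , averages-≤ (λ j → proj₂ (δs-bound j)) (averages-neg (sym δ≡)) angle-average )
      , (λ i → averages-≤ (λ j → ind-nonNeg (vs j i)) (averages-const 0#) (y-average i)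
             , averages-≤ (λ j → ind≤1 (vs j i)) (y-average i) (averages-const 1#))
      , averages-≤ (λ j → ind-nonNeg (intactL j)) (averages-const 0#) refl
      , averages-≤ (λ j → ind≤1 (intactL j)) refl (averages-const 1#)
      , averages-≤ (λ j → ind-nonNeg (intactU j)) (averages-const 0#) refl
      , averages-≤ (λ j → ind≤1 (intactU j)) refl (averages-const 1#)
      where
        open Average λs λs≥0 Σλs≡1

        vs : Fin N → Bits k
        vs j i = toBit (proj₁ (ys∈R j) i)

        ys≡ : ∀ j i → ys j i ≡ ind (vs j i)
        ys≡ j i = ind-toBit (proj₁ (ys∈R j) i)

        intactL intactU : Fin N → Bool
        intactL j = does (intact? L (vs j))
        intactU j = does (intact? U (vs j))

        y-average : ∀ i → Averages (λ j → ind (vs j i)) (y i)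
        y-average i = averages-cong (λ j → ys≡ j i) (sym (y≡ i))

        cut-average : ∀ S → Averages (λ j → ∑On k S (ind ∘ vs j) - card F k S + 1#) (∑On k S y - card F k S + 1#)
        cut-average S = averages-+ (averages-+ (averages-∑On S y-average) (averages-neg (averages-const _))) (averages-const 1#)

        angle-average : Averages (λ j → angleBound (zlᵇ (vs j)) (ζᵇ (vs j)))
                                 (angleBound (average (zlᵇ ∘ vs)) (average (ζᵇ ∘ vs)))
        angle-average = averages-+ (averages-+ (averages-*ˡ wL refl) (averages-*ˡ wU refl))
                                   (averages-*ˡ M (averages-+ (averages-+ (averages-const 1#) (averages-neg refl)) (averages-neg refl)))

        δs-bound : ∀ j → AbsLe F (δs j) (angleBound (zlᵇ (vs j)) (ζᵇ (vs j)))
        δs-bound j = subst (AbsLe F (δs j)) (sym (angleBound-lift (vs j))) (InR⇒≤fibreBound (ys≡ j) (ys∈R j))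

  module Decomposition (k : ℕ) (w : Fin k → Carrier) (w≥0 : ∀ i → 0# ≤ w i) (M : Carrier) (Σw≤M : ∑ k w ≤ M)
                   (L U : Bits k) (U≡¬L : ∀ i → U i ≡ not (L i))
                   (0<wL : 0# < ∑On k L w) (wL≤wU : ∑On k L w ≤ ∑On k U w) where
    open Formulation k w M L U
    open Coupling F

    w≤M : ∀ i → w i ≤ M
    w≤M i = ≤-trans (≤-∑ k w≥0 i) Σw≤M

    wL≥0 : 0# ≤ wL
    wL≥0 = proj₁ 0<wL

    wU≤M : wU ≤ M
    wU≤M = ≤-trans (subst (wU ≤_) (trans (+-comm wU wL) (sym (∑-complement k L U w U≡¬L))) (a≤a+b wL≥0)) Σw≤M

    wL≤M : wL ≤ M
    wL≤M = ≤-trans wL≤wU wU≤M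

    wL≤boundFromIntact : ∀ a b → wL ≤ boundFromIntact a b
    wL≤boundFromIntact true _ = ≤-refl
    wL≤boundFromIntact false true = wL≤wU
    wL≤boundFromIntact false false = wL≤M

    pathBound-base : ∀ S v → ∑On k S w ≤ pathBound S (ind ∘ v)
    pathBound-base S v = a≤a+b (∑On-nonNeg k S (λ i _ → *-nonneg (a≤b⇒0≤b-a (w≤M i)) (a≤b⇒0≤b-a (ind≤1 (v i)))))

    pathBound-broken : ∀ S v → ¬ Intact S v → M ≤ pathBound S (ind ∘ v)
    pathBound-broken S v broken with broken-witness broken
    ... | i , Sᵢ , vᵢ = subst₂ _≤_ term≡M (∑On-distrib-+ k S w _) (≤-∑On k S terms≥0 i Sᵢ)
      where
        terms≥0 : ∀ j → S j ≡ true → 0# ≤ w j + (M - w j) * (1# - ind (v j))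
        terms≥0 j _ = +-nonNeg (w≥0 j) (*-nonneg (a≤b⇒0≤b-a (w≤M j)) (a≤b⇒0≤b-a (ind≤1 (v j))))
        term≡M : w i + (M - w i) * (1# - ind (v i)) ≡ M
        term≡M rewrite vᵢ = solve 2 (λ a m → a :+ (m :- a) :* (:1 :- :0) := m) refl (w i) M

    fibreBound≤pathBounds : ∀ v → (fibreBound v ≤ pathBound L (ind ∘ v)) × (fibreBound v ≤ pathBound U (ind ∘ v))
                                × (fibreBound v ≤ M)
    fibreBound≤pathBounds v = bounds (intact? L v) (intact? U v)
      where
        bounds : (dL : Dec (Intact L v)) (dU : Dec (Intact U v)) →
                 let β = boundFromIntact (does dL) (does dU)
                 in (β ≤ pathBound L (ind ∘ v)) × (β ≤ pathBound U (ind ∘ v)) × (β ≤ M)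
        bounds (yes _) _ = pathBound-base L v , ≤-trans wL≤wU (pathBound-base U v) , wL≤M
        bounds (no brokenL) (yes _) = ≤-trans wU≤M (pathBound-broken L v brokenL) , pathBound-base U v , wU≤M
        bounds (no brokenL) (no brokenU) = pathBound-broken L v brokenL , pathBound-broken U v brokenU , ≤-refl

    ≤fibreBound⇒InR : ∀ {δ} v → AbsLe F δ (fibreBound v) → InR F k w M L U δ (ind ∘ v)
    ≤fibreBound⇒InR v δ≤β with fibreBound≤pathBounds v
    ... | β≤L , β≤U , β≤M =
      ind-binary ∘ v , AbsLe-weaken δ≤β β≤L , AbsLe-weaken δ≤β β≤U , AbsLe-weaken δ≤β β≤M

    wL≤fibreBound : ∀ v → wL ≤ fibreBound v
    wL≤fibreBound v = wL≤boundFromIntact (does (intact? L v)) (does (intact? U v))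

    wU≤fibreBound : ∀ v → ¬ Intact L v → wU ≤ fibreBound v
    wU≤fibreBound v brokenL = bound (intact? L v) (intact? U v)
      where
        bound : (dL : Dec (Intact L v)) (dU : Dec (Intact U v)) → wU ≤ boundFromIntact (does dL) (does dU)
        bound (yes intactL) _ = ⊥-elim (brokenL intactL)
        bound (no _) (yes _) = ≤-refl
        bound (no _) (no _) = wU≤M

    M≤fibreBound : ∀ v → ¬ Intact L v → ¬ Intact U v → M ≤ fibreBound v
    M≤fibreBound v brokenL brokenU = bound (intact? L v) (intact? U v)
      where
        bound : (dL : Dec (Intact L v)) (dU : Dec (Intact U v)) → M ≤ boundFromIntact (does dL) (does dU)
        bound (yes intactL) _ = ⊥-elim (brokenL intactL)
        bound (no _) (yes intactU) = ⊥-elim (brokenU intactU)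
        bound (no _) (no _) = ≤-refl

    -- the mean of fibreBound when ρ̲ breaks with probability p and both paths with probability q
    mixedBound : Carrier → Carrier → Carrier
    mixedBound p q = wL + (wU - wL) * p + (M - wU) * q

    angleBound≡mixedBound : ∀ zl ζ → angleBound zl ζ ≡ mixedBound (1# - zl) (1# - zl - ζ)
    angleBound≡mixedBound zl ζ = solve 5
      (λ wl wu m zl ζ → wl :* zl :+ wu :* ζ :+ m :* (:1 :- zl :- ζ)
                     := wl :+ (wu :- wl) :* (:1 :- zl) :+ (m :- wu) :* (:1 :- zl :- ζ))
      refl wL wU M zl ζ

    mixedBound-mono : ∀ {p p′ q q′} → p ≤ p′ → q ≤ q′ → mixedBound p q ≤ mixedBound p′ q′
    mixedBound-mono p≤p′ q≤q′ =
      +-mono-≤ (+-monoʳ-≤ wL (*-monoˡ-≤-nonNeg _ (a≤b⇒0≤b-a wL≤wU) p≤p′))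
               (*-monoˡ-≤-nonNeg _ (a≤b⇒0≤b-a wU≤M) q≤q′)

    module Bounds {s : State k} {y : Vector Carrier k} (C : IsCoupling L U y s) where
      open IsCoupling C

      B O₁ O₂ O₀ : Carrier
      B = mass (both s)
      O₁ = mass (only₁ s)
      O₂ = mass (only₂ s)
      O₀ = mass (none s)

      mass-pieces : mass (pieces s) ≡ 1#
      mass-pieces = trans (wsum-pieces _ s) total-mass

      wsum-≥ : ∀ a {l : List (Piece k)} → NonNeg l → All (λ p → a ≤ fibreBound (proj₂ p)) l →
               a * mass l ≤ wsum fibreBound l
      wsum-≥ a {l} 0≤l a≤ = subst (_≤ wsum fibreBound l) (wsum-const a l) (wsum-mono-≤ 0≤l a≤)

      wL≤wsum : wL ≤ wsum fibreBound (pieces s)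
      wL≤wsum = subst (_≤ wsum fibreBound (pieces s)) (trans (cong (wL *_) mass-pieces) (*-identityʳ wL))
        (wsum-≥ wL (pieces-nonNeg C) (All.universal (λ p → wL≤fibreBound (proj₂ p)) (pieces s)))

      mixedBound≤wsum : mixedBound (B + O₁) B ≤ wsum fibreBound (pieces s)
      mixedBound≤wsum = begin
        mixedBound (B + O₁) B
          ≡⟨ cong (λ x → x + (wU - wL) * (B + O₁) + (M - wU) * B) (sym (trans (cong (wL *_) total-mass) (*-identityʳ wL))) ⟩
        wL * (B + (O₁ + (O₂ + O₀))) + (wU - wL) * (B + O₁) + (M - wU) * B
          ≡⟨ solve 7 (λ wl wu m b o₁ o₂ n → wl :* (b :+ (o₁ :+ (o₂ :+ n))) :+ (wu :- wl) :* (b :+ o₁) :+ (m :- wu) :* b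
                                         := m :* b :+ (wu :* o₁ :+ (wl :* o₂ :+ wl :* n))) refl wL wU M B O₁ O₂ O₀ ⟩
        M * B + (wU * O₁ + (wL * O₂ + wL * O₀))
          ≤⟨ +-mono-≤ (wsum-≥ M both≥0 (All.map (λ (b₁ , b₂) → M≤fibreBound _ b₁ b₂) (All.zip (both-broken₁ , both-broken₂))))
               (+-mono-≤ (wsum-≥ wU only₁≥0 (All.map (wU≤fibreBound _) only₁-broken))
                 (+-mono-≤ (wsum-≥ wL only₂≥0 (All.universal (λ p → wL≤fibreBound (proj₂ p)) (only₂ s)))
                           (wsum-≥ wL none≥0 (All.universal (λ p → wL≤fibreBound (proj₂ p)) (none s))))) ⟩
        Wt fibreBound s
          ≡⟨ sym (wsum-pieces fibreBound s) ⟩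
        wsum fibreBound (pieces s) ∎
        where open ≤-Reasoning

      angleBound≤wsum : ∀ {zl zu ζ} → 0# ≤ zl → 0# ≤ zu →
                        ∑On k L y - card F k L + 1# ≤ zl → ∑On k U y - card F k U + 1# ≤ zu →
                        0# ≤ ζ → zu - zl ≤ ζ → angleBound zl ζ ≤ wsum fibreBound (pieces s)
      angleBound≤wsum {zl} {zu} {ζ} 0≤zl 0≤zu zl-cut zu-cut 0≤ζ zu-zl≤ζ = begin
        angleBound zl ζ                    ≡⟨ angleBound≡mixedBound zl ζ ⟩
        mixedBound (1# - zl) (1# - zl - ζ) ≤⟨ mixedBound-mono L-broken both-broken ⟩
        mixedBound (B + O₁) B              ≤⟨ mixedBound≤wsum ⟩
        wsum fibreBound (pieces s)         ∎
        where
          open ≤-Reasoning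

          L-broken : 1# - zl ≤ B + O₁
          L-broken = covers₁ (1# - zl) (a-b≤a 0≤zl) (Equivalence.to (conjunctionCut⇔deficit k L y zl) zl-cut)

          U-broken : 1# - zu ≤ B + O₂
          U-broken = covers₂ (1# - zu) (a-b≤a 0≤zu) (Equivalence.to (conjunctionCut⇔deficit k U y zu) zu-cut)

          both-broken : 1# - zl - ζ ≤ B
          both-broken with nested
          ... | inj₁ O₁≡0 = ≤-trans (a-b≤a 0≤ζ) (subst (1# - zl ≤_) (trans (cong (B +_) O₁≡0) (+-identityʳ B)) L-broken)
          ... | inj₂ O₂≡0 = ≤-trans 1-zl-ζ≤1-zu (subst (1# - zu ≤_) (trans (cong (B +_) O₂≡0) (+-identityʳ B)) U-broken)
            where
              1-zl-ζ≤1-zu : 1# - zl - ζ ≤ 1# - zu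
              1-zl-ζ≤1-zu = ≤-byDifference (ζ - (zu - zl)) (a≤b⇒0≤b-a zu-zl≤ζ)
                (solve 3 (λ zl zu ζ → ζ :- (zu :- zl) := (:1 :- zu) :- (:1 :- zl :- ζ)) refl zl zu ζ)

    projection⊆hull : ∀ {δ y} → InProjP F k w M L U δ y → InConvR F k w M L U δ y
    projection⊆hull {δ} {y}
      (zl , zu , ζ , _ , zl-cut , _ , zu-cut , 0≤ζ , _ , _ , zu-zl≤ζ , δ≤angle , 0≤y≤1 , 0≤zl , _ , 0≤zu , _) =
      weightedList⇒InConvR (pieces s) (λ v → fibreBound v * r) (pieces-nonNeg C) mass-pieces
        (λ v → ≤fibreBound⇒InR v (AbsLe-scale (≤-trans wL≥0 (wL≤fibreBound v)) r≤1)) δ≡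
        (λ i → sym (trans (wsum-pieces _ s) (marginal i)))
      where
        s = build k L y
        C : IsCoupling L U y s
        C = build-isCoupling k L U y U≡¬L 0≤y≤1
        open IsCoupling C
        open Bounds C

        S = wsum fibreBound (pieces s)

        S≢0 : ¬ (S ≡ 0#)
        S≢0 = positive⇒≢0 (<-≤-trans 0<wL wL≤wsum)

        S⁻¹ = (S ⁻¹) S≢0
        r = δ * S⁻¹

        r≤1 : AbsLe F r 1#
        r≤1 = AbsLe-normalise S≢0 (≤-trans wL≥0 wL≤wsum)
                (AbsLe-weaken δ≤angle (angleBound≤wsum 0≤zl 0≤zu zl-cut zu-cut 0≤ζ zu-zl≤ζ))

        δ≡ : δ ≡ wsum (λ v → fibreBound v * r) (pieces s)
        δ≡ = sym (begin
          wsum (λ v → fibreBound v * r) (pieces s) ≡⟨ wsum-*ʳ fibreBound r (pieces s) ⟩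
          S * (δ * S⁻¹)                            ≡⟨ solve 3 (λ s d i → s :* (d :* i) := d :* (s :* i)) refl S δ S⁻¹ ⟩
          δ * (S * S⁻¹)                            ≡⟨ cong (δ *_) (⁻¹-inverse S S≢0) ⟩
          δ * 1#                                   ≡⟨ *-identityʳ δ ⟩
          δ                                        ∎)
          where open ≡-Reasoning

  -- A line of L makes ∑On k L w positive, which the normalisation of the angles in Decomposition needs.
  sharp : (k : ℕ) (w : Fin k → Carrier) → (∀ i → 0# < w i) → (M : Carrier) → ∑ k w ≤ M →
          (L U : Bits k) → (∀ i → U i ≡ not (L i)) → (∃ λ i → L i ≡ true) → ∑On k L w < ∑On k U w →
          (δ : Carrier) (y : Vector Carrier k) →
          (InConvR F k w M L U δ y → InProjP F k w M L U δ y) × (InProjP F k w M L U δ y → InConvR F k w M L U δ y)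
  sharp k w 0<w M Σw≤M L U U≡¬L (i , Lᵢ) wL<wU δ y =
      Formulation.hull⊆projection k w M L U
    , Decomposition.projection⊆hull k w (proj₁ ∘ 0<w) M Σw≤M L U U≡¬L 0<wL (proj₁ wL<wU)
    where
      0<wL : 0# < ∑On k L w
      0<wL = <-≤-trans (0<w i) (≤-∑On k L (λ j _ → proj₁ (0<w j)) i Lᵢ)

n<ᵇn≡false : ∀ n → (n ℕ.<ᵇ n) ≡ false
n<ᵇn≡false zero = refl
n<ᵇn≡false (suc n) = n<ᵇn≡false n

arc-inside : ∀ {k} (m n : Fin k) {i} →
             toℕ m ℕ.⊓ toℕ n ℕ.≤ toℕ i → toℕ i ℕ.< toℕ m ℕ.⊔ toℕ n → arc m n i ≡ true
arc-inside m n min≤i i<max = Equivalence.to T-≡ (Equivalence.from T-∧ (ℕ.≤⇒≤ᵇ min≤i , ℕ.<⇒<ᵇ i<max))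

arc-at-max : ∀ {k} (m n : Fin k) {i} → toℕ i ≡ toℕ m ℕ.⊔ toℕ n → arc m n i ≡ false
arc-at-max m n {i} i≡max rewrite sym i≡max | n<ᵇn≡false (toℕ i) = ∧-zeroʳ _

arc-nonempty : ∀ {k} {m n : Fin k} → ¬ m ≡ n → ∃ λ i → arc m n i ≡ true
arc-nonempty {m = m} {n} m≢n with ℕ.<-cmp (toℕ m) (toℕ n)
... | tri< m<n _ _ = m , arc-inside m n (ℕ.m⊓n≤m (toℕ m) (toℕ n)) (ℕ.<-≤-trans m<n (ℕ.m≤n⊔m (toℕ m) (toℕ n)))
... | tri≈ _ m≡n _ = ⊥-elim (m≢n (toℕ-injective m≡n))
... | tri> _ _ n<m = n , arc-inside m n (ℕ.m⊓n≤n (toℕ m) (toℕ n)) (ℕ.<-≤-trans n<m (ℕ.m≤m⊔n (toℕ m) (toℕ n)))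

coarc-nonempty : ∀ {k} {m n : Fin k} → ¬ m ≡ n → ∃ λ i → coarc m n i ≡ true
coarc-nonempty {m = m} {n} m≢n with ℕ.<-cmp (toℕ m) (toℕ n)
... | tri< m<n _ _ = n , cong not (arc-at-max m n (sym (ℕ.m≤n⇒m⊔n≡n (ℕ.<⇒≤ m<n))))
... | tri≈ _ m≡n _ = ⊥-elim (m≢n (toℕ-injective m≡n))
... | tri> _ _ n<m = m , cong not (arc-at-max m n (sym (ℕ.m≥n⇒m⊔n≡m (ℕ.<⇒≤ n<m))))

theorem1 : {c ℓ : Level} (F : OrderedField c ℓ) →
    let open OrderedField F in
    (k : ℕ) (w : Fin k → Carrier) → (∀ i → 0# < w i) →
    (M : Carrier) → Σ[_] F k w ≤ M →
    (m n : Fin k) → ¬ (m ≡ n) →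
    -- b = true: the lower path ρ̲ is the arc, else ρ̲ is the complementary arc
    (b : Bool) →
    let L = if b then arc m n else coarc m n in
    let U = if b then coarc m n else arc m n in
    ΣOn F k L w < ΣOn F k U w →
    (δ : Carrier) (y : Fin k → Carrier) →
    (InConvR F k w M L U δ y → InProjP F k w M L U δ y)
    × (InProjP F k w M L U δ y → InConvR F k w M L U δ y)
theorem1 F k w 0<w M Σw≤M m n m≢n true =
  Sharpness.sharp F k w 0<w M Σw≤M (arc m n) (coarc m n) (λ _ → refl) (arc-nonempty m≢n)
theorem1 F k w 0<w M Σw≤M m n m≢n false =
  Sharpness.sharp F k w 0<w M Σw≤M (coarc m n) (arc m n) (λ i → sym (not-involutive (arc m n i))) (coarc-nonempty m≢n)
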